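{- For every ST-program P over V-structures, there is an existential formula φ_P[f_1,…,f_n, g_1,…,g_n] (with f_1,…,f_n and g_1,…,g_n vectors of function variables whose arities match the identifiers of V) that holds iff the structure given by (f_1,…,f_n) yields the structure given by (g_1,…,g_n) under P, i.e. iff (f_1,…,f_n) is transformed by P into (g_1,…,g_n).
   Context: Setting: A is a denumerable set of unstructured atoms, extended with a fresh element ⊥ ("undefined"). A k-ary A-function is a finite partial function from A^k to A, identified with its strict total extension to A_⊥ (output ⊥ whenever the function is undefined or some input is ⊥). A vocabulary V is a finite set of function identifiers f_1,…,f_n with arities; an A-structure over V assigns to each identifier of arity k a k-ary A-function. Terms are built from the constant ω (always denoting ⊥) and function identifiers/variables by application. Formulas are second-order: built from equations t ≐ q between terms by propositional connectives and quantifiers ∀f, ∃f over variables f of any arity k ≥ 0, where quantifiers range over all finite A-functions of that arity (nullary variables range over A_⊥). A formula is existential if it has the form of existential quantifiers (atomic or functional) applied to a first-order formula (one whose quantifiers are only over atomic variables); conjunctions/disjunctions of existential formulas with first-order formulas are also existential in this sense. ST-programs over V: the basic operations (revisions) are: extension f t_1…t_k := q (if f t_1…t_k is undefined, set it to the value of q); inception c⇓ for a token c (if c is undefined, set it to a fresh atom not in the scope of the structure); contraction f t_1…t_k↑ (make f t_1…t_k undefined); deletion c⇑ (remove the atom denoted by c, i.e. make every entry whose value is that atom undefined). Programs are generated from revisions by composition P;Q, branching if[G]{P}{Q}, and iteration do[G]{P}, where a guard G is a quantifier-free formula. The binary yield relation ⇒_P between structures is defined by recursion on P in the usual way (for revisions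 following the intended semantics above; for do[G]{P}, repeat P while G holds, ending in a structure falsifying G). -}

module Defs where

open import Data.Nat using (ℕ; zero; suc)
import Data.Nat as ℕ
open import Data.Maybe using (Maybe; just; nothing; _<∣>_)
open import Data.Product using (Σ; _×_; _,_; ∃; proj₂)
open import Data.Sum using (_⊎_)
open import Data.Empty using (⊥)
open import Data.List using (List; []; _∷_)
open import Data.List.Membership.Propositional using (_∈_)
open import Data.List.Relation.Unary.All using (All; lookup)
open import Data.Vec using (Vec; []; _∷_)
import Data.Vec.Membership.Propositional as VecMem
open import Data.Vec.Properties using (≡-dec)
open import Relation.Binary.PropositionalEquality using (_≡_; _≢_)
open import Relation.Nullary using (¬_; yes; no)

-- A denumerable set of atoms: ℕ.  A_⊥ = Maybe ℕ, with nothing = ⊥.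
Atom : Set
Atom = ℕ

Atom⊥ : Set
Atom⊥ = Maybe Atom

-- A finite A-function is represented by a finite association list of
-- graph entries (arguments , value); application returns the first
-- matching entry.  Every list denotes a finite partial function and every
-- finite partial function is denoted by some list, so quantifying over
-- lists is quantifying over all finite A-functions.  Everything below
-- (formula semantics, yield relation) depends only on the denoted
-- function, never on the representing list.

FinFun : ℕ → Set
FinFun k = List (Vec Atom k × Atom)

apply : ∀ {k} → FinFun k → Vec Atom k → Atom⊥
apply [] v = nothing
apply ((u , a) ∷ es) v with ≡-dec ℕ._≟_ u v
... | yes _ = just a
... | no  _ = apply es v

allJust : ∀ {k} → Vec Atom⊥ k → Maybe (Vec Atom k)
allJust [] = just []
allJust (nothing ∷ vs) = nothing
allJust (just a ∷ vs) with allJust vs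
... | just as = just (a ∷ as)
... | nothing = nothing

apply⊥ : ∀ {k} → FinFun k → Vec Atom⊥ k → Atom⊥
apply⊥ f vs with allJust vs
... | just as = apply f as
... | nothing = nothing

-- A context (and a vocabulary) is a list of arities; identifiers /
-- variables are positions in it (proof-relevant membership k ∈ Γ).

Ctx : Set
Ctx = List ℕ

Vocabulary : Set
Vocabulary = List ℕ

Env : Ctx → Set
Env Γ = All FinFun Γ

Struct : Vocabulary → Set
Struct V = Env V

data Term (Γ : Ctx) : Set where
  ω   : Term Γ
  app : ∀ {k} → k ∈ Γ → Vec (Term Γ) k → Term Γ

infix 4 _≐_
data Formula (Γ : Ctx) : Set where
  _≐_  : Term Γ → Term Γ → Formula Γ
  neg  : Formula Γ → Formula Γ
  conj : Formula Γ → Formula Γ → Formula Γ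
  disj : Formula Γ → Formula Γ → Formula Γ
  impl : Formula Γ → Formula Γ → Formula Γ
  all  : (k : ℕ) → Formula (k ∷ Γ) → Formula Γ
  ex   : (k : ℕ) → Formula (k ∷ Γ) → Formula Γ

mutual
  eval : ∀ {Γ} → Env Γ → Term Γ → Atom⊥
  eval ρ ω = nothing
  eval ρ (app x ts) = apply⊥ (lookup ρ x) (evalVec ρ ts)

  evalVec : ∀ {Γ k} → Env Γ → Vec (Term Γ) k → Vec Atom⊥ k
  evalVec ρ [] = []
  evalVec ρ (t ∷ ts) = eval ρ t ∷ evalVec ρ ts

-- Tarskian semantics; quantifiers over variables of arity k range over
-- all finite k-ary A-functions (for k = 0: over A_⊥).
⟦_⟧ : ∀ {Γ} → Formula Γ → Env Γ → Set
⟦ t ≐ q ⟧ ρ = eval ρ t ≡ eval ρ q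
⟦ neg φ ⟧ ρ = ¬ ⟦ φ ⟧ ρ
⟦ conj φ ψ ⟧ ρ = ⟦ φ ⟧ ρ × ⟦ ψ ⟧ ρ
⟦ disj φ ψ ⟧ ρ = ⟦ φ ⟧ ρ ⊎ ⟦ ψ ⟧ ρ
⟦ impl φ ψ ⟧ ρ = ⟦ φ ⟧ ρ → ⟦ ψ ⟧ ρ
⟦ all k φ ⟧ ρ = (f : FinFun k) → ⟦ φ ⟧ (f All.∷ ρ)
  where import Data.List.Relation.Unary.All as All
⟦ ex k φ ⟧ ρ = Σ (FinFun k) λ f → ⟦ φ ⟧ (f All.∷ ρ)
  where import Data.List.Relation.Unary.All as All

data QF {Γ : Ctx} : Formula Γ → Set where
  qf-eq   : ∀ {t q} → QF (t ≐ q)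
  qf-neg  : ∀ {φ} → QF φ → QF (neg φ)
  qf-conj : ∀ {φ ψ} → QF φ → QF ψ → QF (conj φ ψ)
  qf-disj : ∀ {φ ψ} → QF φ → QF ψ → QF (disj φ ψ)
  qf-impl : ∀ {φ ψ} → QF φ → QF ψ → QF (impl φ ψ)

data FO : {Γ : Ctx} → Formula Γ → Set where
  fo-eq   : ∀ {Γ} {t q : Term Γ} → FO (t ≐ q)
  fo-neg  : ∀ {Γ} {φ : Formula Γ} → FO φ → FO (neg φ)
  fo-conj : ∀ {Γ} {φ ψ : Formula Γ} → FO φ → FO ψ → FO (conj φ ψ)
  fo-disj : ∀ {Γ} {φ ψ : Formula Γ} → FO φ → FO ψ → FO (disj φ ψ)
  fo-impl : ∀ {Γ} {φ ψ : Formula Γ} → FO φ → FO ψ → FO (impl φ ψ)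
  fo-all  : ∀ {Γ} {φ : Formula (0 ∷ Γ)} → FO φ → FO (all 0 φ)
  fo-ex   : ∀ {Γ} {φ : Formula (0 ∷ Γ)} → FO φ → FO (ex 0 φ)

data Existential : {Γ : Ctx} → Formula Γ → Set where
  ex-fo   : ∀ {Γ} {φ : Formula Γ} → FO φ → Existential φ
  ex-ex   : ∀ {Γ k} {φ : Formula (k ∷ Γ)} → Existential φ → Existential (ex k φ)
  ex-conj : ∀ {Γ} {φ ψ : Formula Γ} → Existential φ → Existential ψ → Existential (conj φ ψ)
  ex-disj : ∀ {Γ} {φ ψ : Formula Γ} → Existential φ → Existential ψ → Existential (disj φ ψ)

Loc : Vocabulary → Set
Loc V = Σ ℕ λ k → Σ (k ∈ V) λ _ → Vec Atom k

val : ∀ {V} → Struct V → Loc V → Atom⊥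
val S (k , x , as) = apply (lookup S x) as

Same : ∀ {V} → Struct V → Struct V → Set
Same S S' = ∀ ℓ → val S' ℓ ≡ val S ℓ

Update : ∀ {V} → Loc _ → Atom⊥ → Struct V → Struct V → Set
Update {V} ℓ m S S' =
  (val S' ℓ ≡ m) × (∀ ℓ' → ℓ' ≢ ℓ → val S' ℓ' ≡ val S ℓ')

InScope : ∀ {V} → Struct V → Atom → Set
InScope S a =
  Σ (Loc _) λ ℓ → Σ Atom λ b → (val S ℓ ≡ just b) ×
    (VecMem._∈_ a (proj₂ (proj₂ ℓ)) ⊎ b ≡ a)

data Prog (V : Vocabulary) : Set where
  extend   : ∀ {k} → k ∈ V → Vec (Term V) k → Term V → Prog V
  incept   : 0 ∈ V → Prog V
  contract : ∀ {k} → k ∈ V → Vec (Term V) k → Prog V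
  delete   : 0 ∈ V → Prog V
  _⨾_      : Prog V → Prog V → Prog V
  ifte     : (G : Formula V) → QF G → Prog V → Prog V → Prog V
  doWhile  : (G : Formula V) → QF G → Prog V → Prog V

ExtendR : ∀ {V k} → k ∈ V → Vec (Term V) k → Term V → Struct V → Struct V → Set
ExtendR {V} {k} x ts q S S' with allJust (evalVec S ts)
... | nothing = Same S S'
... | just as = Update (k , x , as) (val S (k , x , as) <∣> eval S q) S S'

ContractR : ∀ {V k} → k ∈ V → Vec (Term V) k → Struct V → Struct V → Set
ContractR {V} {k} x ts S S' with allJust (evalVec S ts)
... | nothing = Same S S'
... | just as = Update (k , x , as) nothing S S'

InceptR : ∀ {V} → 0 ∈ V → Struct V → Struct V → Set
InceptR {V} c S S' with val S (0 , c , [])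
... | just _  = Same S S'
... | nothing = Σ Atom λ a → ¬ InScope S a × Update (0 , c , []) (just a) S S'

DeleteR : ∀ {V} → 0 ∈ V → Struct V → Struct V → Set
DeleteR {V} c S S' with val S (0 , c , [])
... | nothing = Same S S'
... | just a  = ∀ ℓ → (val S ℓ ≡ just a → val S' ℓ ≡ nothing)
                    × (val S ℓ ≢ just a → val S' ℓ ≡ val S ℓ)

data Yields {V : Vocabulary} : Prog V → Struct V → Struct V → Set where
  y-extend   : ∀ {k} {x : k ∈ V} {ts q S S'} → ExtendR x ts q S S' → Yields (extend x ts q) S S'
  y-incept   : ∀ {c S S'} → InceptR c S S' → Yields (incept c) S S'
  y-contract : ∀ {k} {x : k ∈ V} {ts S S'} → ContractR x ts S S' → Yields (contract x ts) S S'
  y-delete   : ∀ {c S S'} → DeleteR c S S' → Yields (delete c) S S'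
  y-seq      : ∀ {P Q S S₁ S'} → Yields P S S₁ → Yields Q S₁ S' → Yields (P ⨾ Q) S S'
  y-ifT      : ∀ {G g P Q S S'} → ⟦ G ⟧ S → Yields P S S' → Yields (ifte G g P Q) S S'
  y-ifF      : ∀ {G g P Q S S'} → ¬ ⟦ G ⟧ S → Yields Q S S' → Yields (ifte G g P Q) S S'
  y-doF      : ∀ {G g P S S'} → ¬ ⟦ G ⟧ S → Same S S' → Yields (doWhile G g P) S S'
  y-doT      : ∀ {G g P S S₁ S'} → ⟦ G ⟧ S → Yields P S S₁ →
               Yields (doWhile G g P) S₁ S' → Yields (doWhile G g P) S S'

-- A program P is captured by a first-order formula ψ_P about the old structure,
-- the new structure and finitely many auxiliary functions, which are then
-- quantified existentially.  A revision changes at most one entry, so ψ_P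
-- describes that entry and states that every other location, a universally
-- quantified tuple of atoms, keeps its value.  For P ⨾ Q the intermediate
-- structure becomes an auxiliary function, and a branch is a disjunction
-- guarded by G.  For a loop the whole run is guessed: each function of the run
-- gets an extra first argument, an index atom, and a unary function N on
-- indices orders the iterations.  First-order axioms say that N is injective,
-- never returns the initial index z, and is defined along its path from z
-- until the final index e; since N is finite, that path reaches e.

module Submission where

open import Defs
open import Data.Nat using (ℕ; zero; suc; _+_; _<_; _≤_; z≤n; s≤s)
import Data.Nat as ℕ
import Data.Nat.Properties as ℕP
open import Data.List using ([]; _∷_; _++_; length)
import Data.List as L
open import Data.List.Relation.Unary.All using ([]; _∷_; lookup)
open import Data.List.Relation.Unary.All.Properties using (++⁺)
open import Data.List.Relation.Unary.Any using (here; there)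
open import Data.List.Relation.Unary.Any.Properties using (++⁺ˡ; ++⁺ʳ; ++⁻)
open import Data.List.Membership.Propositional using (_∈_)
open import Data.Vec using (Vec; []; _∷_)
import Data.Vec as Vec
import Data.Vec.Properties as VecP
open import Data.Vec.Properties using (≡-dec; ∷-injectiveʳ; ∷-injectiveˡ)
import Data.Vec.Relation.Unary.All as VAll
import Data.Vec.Relation.Unary.All.Properties as VAllP
import Data.Vec.Relation.Unary.Any as VAny
import Data.Vec.Membership.Propositional as VecMem
open import Data.Maybe using (just; nothing; _<∣>_)
open import Data.Maybe.Properties using (just-injective; <∣>-identityʳ)
open import Data.Product using (Σ; _×_; _,_; proj₁; proj₂)
open import Data.Product.Function.NonDependent.Propositional using (_×-⇔_)
open import Data.Sum using (_⊎_; inj₁; inj₂; [_,_]; [_,_]′)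
open import Data.Sum.Function.Propositional using (_⊎-⇔_)
open import Data.Empty using (⊥-elim)
open import Function.Bundles using (_⇔_; mk⇔; Equivalence)
import Function.Properties.Equivalence as ⇔
open import Function.Related.TypeIsomorphisms using (→-cong-⇔; ¬-cong-⇔)
open import Relation.Binary.PropositionalEquality hiding ([_])
open import Relation.Nullary using (¬_; yes; no; Dec)

open Equivalence using (to; from)

subst-⇔ : ∀ {A : Set} (P : A → Set) {a a'} → a ≡ a' → P a ⇔ P a'
subst-⇔ P refl = ⇔.refl

subst₂-⇔ : ∀ {A B : Set} (R : A → B → Set) {a a' b b'} → a ≡ a' → b ≡ b' → R a b ⇔ R a' b'
subst₂-⇔ R refl refl = ⇔.refl

≡-⇔ : ∀ {A : Set} {a b a' b' : A} → a ≡ a' → b ≡ b' → (a ≡ b) ⇔ (a' ≡ b')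
≡-⇔ = subst₂-⇔ _≡_

Π-⇔ : ∀ {A : Set} {P Q : A → Set} → (∀ a → P a ⇔ Q a) → ((a : A) → P a) ⇔ ((a : A) → Q a)
Π-⇔ h = mk⇔ (λ p a → to (h a) (p a)) (λ q a → from (h a) (q a))

Σ-⇔ : ∀ {A : Set} {P Q : A → Set} → (∀ a → P a ⇔ Q a) → Σ A P ⇔ Σ A Q
Σ-⇔ h = mk⇔ (λ (a , p) → a , to (h a) p) (λ (a , q) → a , from (h a) q)

just≢nothing : ∀ {x : Atom} → just x ≢ nothing
just≢nothing ()

≢nothing⇒just : ∀ (u : Atom⊥) → u ≢ nothing → Σ Atom λ a → u ≡ just a
≢nothing⇒just nothing defined = ⊥-elim (defined refl)
≢nothing⇒just (just a) _ = a , refl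

allJust-map-just : ∀ {k} (as : Vec Atom k) → allJust (Vec.map just as) ≡ just as
allJust-map-just [] = refl
allJust-map-just (a ∷ as) rewrite allJust-map-just as = refl

allJust≡just⇒ : ∀ {k} (vs : Vec Atom⊥ k) {as} → allJust vs ≡ just as → vs ≡ Vec.map just as
allJust≡just⇒ [] refl = refl
allJust≡just⇒ (nothing ∷ vs) ()
allJust≡just⇒ (just a ∷ vs) eq with allJust vs in e
allJust≡just⇒ (just a ∷ vs) refl | just bs = cong (just a ∷_) (allJust≡just⇒ vs e)

map-just-injective : ∀ {k} (as bs : Vec Atom k) → Vec.map just as ≡ Vec.map just bs → as ≡ bs
map-just-injective [] [] e = refl
map-just-injective (a ∷ as) (b ∷ bs) e =
  cong₂ _∷_ (just-injective (∷-injectiveˡ e)) (map-just-injective as bs (∷-injectiveʳ e))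

apply⊥-map-just : ∀ {k} (f : FinFun k) (as : Vec Atom k) → apply⊥ f (Vec.map just as) ≡ apply f as
apply⊥-map-just f as rewrite allJust-map-just as = refl

apply⊥-defined : ∀ {k} (f : FinFun k) (vs : Vec Atom⊥ k) {as} →
  allJust vs ≡ just as → apply⊥ f vs ≡ apply f as
apply⊥-defined f vs e with allJust vs
apply⊥-defined f vs refl | just _ = refl

apply⊥-undefined : ∀ {k} (f : FinFun k) (vs : Vec Atom⊥ k) →
  allJust vs ≡ nothing → apply⊥ f vs ≡ nothing
apply⊥-undefined f vs e with allJust vs
apply⊥-undefined f vs refl | nothing = refl

apply⊥-[] : ∀ {k} (vs : Vec Atom⊥ k) → apply⊥ [] vs ≡ nothing
apply⊥-[] vs with allJust vs
... | just _ = refl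
... | nothing = refl

graft : ∀ {k} → Atom → FinFun k → FinFun (suc k)
graft a [] = []
graft a ((u , v) ∷ e) = (a ∷ u , v) ∷ graft a e

apply-graft-++-same : ∀ {k} (f : FinFun k) (w : FinFun (suc k)) a as →
  apply (graft a f ++ w) (a ∷ as) ≡ (apply f as <∣> apply w (a ∷ as))
apply-graft-++-same [] w a as = refl
apply-graft-++-same ((u , v) ∷ f) w a as with ≡-dec ℕ._≟_ u as | ≡-dec ℕ._≟_ (a ∷ u) (a ∷ as)
... | yes p | yes q = refl
... | yes p | no nq = ⊥-elim (nq (cong (a ∷_) p))
... | no np | yes q = ⊥-elim (np (∷-injectiveʳ q))
... | no np | no nq = apply-graft-++-same f w a as

apply-graft-++-other : ∀ {k} (f : FinFun k) (w : FinFun (suc k)) a b as → a ≢ b →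
  apply (graft a f ++ w) (b ∷ as) ≡ apply w (b ∷ as)
apply-graft-++-other [] w a b as ne = refl
apply-graft-++-other ((u , v) ∷ f) w a b as ne with ≡-dec ℕ._≟_ (a ∷ u) (b ∷ as)
... | yes q = ⊥-elim (ne (∷-injectiveˡ q))
... | no nq = apply-graft-++-other f w a b as ne

section : ∀ {k} → FinFun (suc k) → Atom → FinFun k
section [] a = []
section ((b ∷ u , v) ∷ es) a with b ℕ.≟ a
... | yes _ = (u , v) ∷ section es a
... | no _ = section es a

apply-section : ∀ {k} (H : FinFun (suc k)) a as → apply (section H a) as ≡ apply H (a ∷ as)
apply-section [] a as = refl
apply-section ((b ∷ u , v) ∷ es) a as with b ℕ.≟ a
apply-section ((b ∷ u , v) ∷ es) a as | yes refl with ≡-dec ℕ._≟_ u as | ≡-dec ℕ._≟_ (b ∷ u) (b ∷ as)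
... | yes p | yes q = refl
... | yes p | no nq = ⊥-elim (nq (cong (b ∷_) p))
... | no np | yes q = ⊥-elim (np (∷-injectiveʳ q))
... | no np | no nq = apply-section es a as
apply-section ((b ∷ u , v) ∷ es) a as | no ne with ≡-dec ℕ._≟_ (b ∷ u) (a ∷ as)
... | yes q = ⊥-elim (ne (∷-injectiveˡ q))
... | no nq = apply-section es a as

section⊥ : ∀ {k} → FinFun (suc k) → Atom⊥ → FinFun k
section⊥ H nothing = []
section⊥ H (just a) = section H a

apply⊥-section⊥ : ∀ {k} (H : FinFun (suc k)) v (vs : Vec Atom⊥ k) →
  apply⊥ (section⊥ H v) vs ≡ apply⊥ H (v ∷ vs)
apply⊥-section⊥ H nothing vs = apply⊥-[] vs
apply⊥-section⊥ H (just a) vs with allJust vs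
... | just as = apply-section H a as
... | nothing = refl

lookup-++⁺ˡ : ∀ {Δ Γ : Ctx} (η : Env Δ) (ρ : Env Γ) {k} (x : k ∈ Δ) →
  lookup (++⁺ η ρ) (++⁺ˡ x) ≡ lookup η x
lookup-++⁺ˡ (e ∷ η) ρ (here refl) = refl
lookup-++⁺ˡ (e ∷ η) ρ (there x) = lookup-++⁺ˡ η ρ x

lookup-++⁺ʳ : ∀ {Γ} (Δ : Ctx) (η : Env Δ) (ρ : Env Γ) {k} (x : k ∈ Γ) →
  lookup (++⁺ η ρ) (++⁺ʳ Δ x) ≡ lookup ρ x
lookup-++⁺ʳ [] [] ρ x = refl
lookup-++⁺ʳ (_ ∷ Δ) (e ∷ η) ρ x = lookup-++⁺ʳ Δ η ρ x

lookup-++⁺ : ∀ {Γ} (Δ : Ctx) (η : Env Δ) (ρ : Env Γ) {k} (x : k ∈ Δ ++ Γ) →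
  lookup (++⁺ η ρ) x ≡ [ lookup η , lookup ρ ] (++⁻ Δ x)
lookup-++⁺ [] [] ρ x = refl
lookup-++⁺ (_ ∷ Δ) (e ∷ η) ρ (here refl) = refl
lookup-++⁺ (_ ∷ Δ) (e ∷ η) ρ (there x) with ++⁻ Δ x | lookup-++⁺ Δ η ρ x
... | inj₁ y | eq = eq
... | inj₂ y | eq = eq

++⁺-surjective : ∀ {Γ} (Δ : Ctx) (η : Env (Δ ++ Γ)) → Σ (Env Δ) λ a → Σ (Env Γ) λ b → ++⁺ a b ≡ η
++⁺-surjective [] η = [] , η , refl
++⁺-surjective (k ∷ Δ) (f ∷ η) with ++⁺-surjective Δ η
... | a , b , refl = f ∷ a , b , refl

emptyEnv : (Δ : Ctx) → Env Δ
emptyEnv [] = []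
emptyEnv (k ∷ Δ) = [] ∷ emptyEnv Δ

lookup-emptyEnv : ∀ (Δ : Ctx) {k} (x : k ∈ Δ) → lookup (emptyEnv Δ) x ≡ []
lookup-emptyEnv (_ ∷ Δ) (here refl) = refl
lookup-emptyEnv (_ ∷ Δ) (there x) = lookup-emptyEnv Δ x

infix 4 _≋_
record _≋_ {Γ} (ρ ρ' : Env Γ) : Set where
  constructor ≋-intro
  field ≋-apply : ∀ {k} (x : k ∈ Γ) (vs : Vec Atom⊥ k) → apply⊥ (lookup ρ x) vs ≡ apply⊥ (lookup ρ' x) vs
open _≋_ public

≋-refl : ∀ {Γ} {ρ : Env Γ} → ρ ≋ ρ
≋-refl = ≋-intro (λ x vs → refl)

≋-sym : ∀ {Γ} {ρ ρ' : Env Γ} → ρ ≋ ρ' → ρ' ≋ ρ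
≋-sym e = ≋-intro (λ x vs → sym (≋-apply e x vs))

≋-trans : ∀ {Γ} {ρ ρ' ρ'' : Env Γ} → ρ ≋ ρ' → ρ' ≋ ρ'' → ρ ≋ ρ''
≋-trans e₁ e₂ = ≋-intro (λ x vs → trans (≋-apply e₁ x vs) (≋-apply e₂ x vs))

≋-∷ : ∀ {Γ k} {ρ ρ' : Env Γ} (f : FinFun k) → ρ ≋ ρ' → (f ∷ ρ) ≋ (f ∷ ρ')
≋-∷ f e = ≋-intro λ { (here refl) vs → refl ; (there x) vs → ≋-apply e x vs }

≋-++⁺ : ∀ {Γ} (Δ : Ctx) {η η' : Env Δ} {ρ ρ' : Env Γ} →
  η ≋ η' → ρ ≋ ρ' → ++⁺ η ρ ≋ ++⁺ η' ρ'
≋-++⁺ Δ {η} {η'} {ρ} {ρ'} e₁ e₂ = ≋-intro pointwise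
  where
  pointwise : ∀ {k} x (vs : Vec Atom⊥ k) →
    apply⊥ (lookup (++⁺ η ρ) x) vs ≡ apply⊥ (lookup (++⁺ η' ρ') x) vs
  pointwise x vs rewrite lookup-++⁺ Δ η ρ x | lookup-++⁺ Δ η' ρ' x with ++⁻ Δ x
  ... | inj₁ y = ≋-apply e₁ y vs
  ... | inj₂ y = ≋-apply e₂ y vs

Same⇒≋ : ∀ {V} {S S' : Struct V} → Same S S' → S' ≋ S
Same⇒≋ {S = S} {S'} h = ≋-intro pointwise
  where
  pointwise : ∀ {k} x (vs : Vec Atom⊥ k) → apply⊥ (lookup S' x) vs ≡ apply⊥ (lookup S x) vs
  pointwise {k} x vs with allJust vs
  ... | just as = h (k , x , as)
  ... | nothing = refl

≋⇒Same : ∀ {V} {S S' : Struct V} → S' ≋ S → Same S S'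
≋⇒Same {S = S} {S'} h (k , x , as) =
  trans (sym (apply⊥-map-just (lookup S' x) as))
        (trans (≋-apply h x (Vec.map just as)) (apply⊥-map-just (lookup S x) as))

-- Substitutions

-- A k-ary variable is replaced by an (m + k)-ary variable whose first m
-- arguments are nullary variables.  Sections of the functions that encode
-- a run of a loop are accessed this way.
record Target (Γ : Ctx) (k : ℕ) : Set where
  constructor target
  field
    extra  : ℕ
    var    : (extra + k) ∈ Γ
    params : Vec (0 ∈ Γ) extra
open Target

Subst : Ctx → Ctx → Set
Subst Γ Γ' = ∀ {k} → k ∈ Γ → Target Γ' k

atomTerms : ∀ {Γ m} → Vec (0 ∈ Γ) m → Vec (Term Γ) m
atomTerms = Vec.map (λ p → app p [])

mutual
  substTerm : ∀ {Γ Γ'} → Subst Γ Γ' → Term Γ → Term Γ'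
  substTerm σ ω = ω
  substTerm σ (app x ts) = app (var (σ x)) (atomTerms (params (σ x)) Vec.++ substTerms σ ts)

  substTerms : ∀ {Γ Γ' n} → Subst Γ Γ' → Vec (Term Γ) n → Vec (Term Γ') n
  substTerms σ [] = []
  substTerms σ (t ∷ ts) = substTerm σ t ∷ substTerms σ ts

liftSubst : ∀ {Γ Γ' j} → Subst Γ Γ' → Subst (j ∷ Γ) (j ∷ Γ')
liftSubst σ (here p) = target 0 (here p) []
liftSubst σ (there x) = target (extra (σ x)) (there (var (σ x))) (Vec.map there (params (σ x)))

substFormula : ∀ {Γ Γ'} → Subst Γ Γ' → Formula Γ → Formula Γ'
substFormula σ (t ≐ q) = substTerm σ t ≐ substTerm σ q
substFormula σ (neg φ) = neg (substFormula σ φ)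
substFormula σ (conj φ ψ) = conj (substFormula σ φ) (substFormula σ ψ)
substFormula σ (disj φ ψ) = disj (substFormula σ φ) (substFormula σ ψ)
substFormula σ (impl φ ψ) = impl (substFormula σ φ) (substFormula σ ψ)
substFormula σ (all k φ) = all k (substFormula (liftSubst σ) φ)
substFormula σ (ex k φ) = ex k (substFormula (liftSubst σ) φ)

atomValue : ∀ {Γ} → Env Γ → 0 ∈ Γ → Atom⊥
atomValue ρ p = apply⊥ (lookup ρ p) []

-- ρ is the environment that ρ' induces along σ.
record Agree {Γ Γ'} (σ : Subst Γ Γ') (ρ : Env Γ) (ρ' : Env Γ') : Set where
  constructor agreeing
  field
    agree : ∀ {k} (x : k ∈ Γ) (vs : Vec Atom⊥ k) →
      apply⊥ (lookup ρ x) vs ≡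
      apply⊥ (lookup ρ' (var (σ x))) (Vec.map (atomValue ρ') (params (σ x)) Vec.++ vs)
open Agree

evalVec-++ : ∀ {Γ m n} (ρ : Env Γ) (xs : Vec (Term Γ) m) (ys : Vec (Term Γ) n) →
  evalVec ρ (xs Vec.++ ys) ≡ evalVec ρ xs Vec.++ evalVec ρ ys
evalVec-++ ρ [] ys = refl
evalVec-++ ρ (x ∷ xs) ys = cong (eval ρ x ∷_) (evalVec-++ ρ xs ys)

evalVec-atomTerms : ∀ {Γ m} (ρ : Env Γ) (ps : Vec (0 ∈ Γ) m) →
  evalVec ρ (atomTerms ps) ≡ Vec.map (atomValue ρ) ps
evalVec-atomTerms ρ [] = refl
evalVec-atomTerms ρ (p ∷ ps) = cong (atomValue ρ p ∷_) (evalVec-atomTerms ρ ps)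

mutual
  eval-subst : ∀ {Γ Γ'} {σ : Subst Γ Γ'} {ρ ρ'} → Agree σ ρ ρ' → (t : Term Γ) →
    eval ρ' (substTerm σ t) ≡ eval ρ t
  eval-subst r ω = refl
  eval-subst {σ = σ} {ρ} {ρ'} r (app x ts) = begin
    apply⊥ (lookup ρ' (var (σ x))) (evalVec ρ' (atomTerms (params (σ x)) Vec.++ substTerms σ ts))
      ≡⟨ cong (apply⊥ (lookup ρ' (var (σ x)))) (evalVec-++ ρ' (atomTerms (params (σ x))) (substTerms σ ts)) ⟩
    apply⊥ (lookup ρ' (var (σ x))) (evalVec ρ' (atomTerms (params (σ x))) Vec.++ evalVec ρ' (substTerms σ ts))
      ≡⟨ cong₂ (λ us ws → apply⊥ (lookup ρ' (var (σ x))) (us Vec.++ ws))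
               (evalVec-atomTerms ρ' (params (σ x))) (evalVec-subst r ts) ⟩
    apply⊥ (lookup ρ' (var (σ x))) (Vec.map (atomValue ρ') (params (σ x)) Vec.++ evalVec ρ ts)
      ≡⟨ agree r x (evalVec ρ ts) ⟨
    apply⊥ (lookup ρ x) (evalVec ρ ts) ∎
    where open ≡-Reasoning

  evalVec-subst : ∀ {Γ Γ' n} {σ : Subst Γ Γ'} {ρ ρ'} → Agree σ ρ ρ' → (ts : Vec (Term Γ) n) →
    evalVec ρ' (substTerms σ ts) ≡ evalVec ρ ts
  evalVec-subst r [] = refl
  evalVec-subst r (t ∷ ts) = cong₂ _∷_ (eval-subst r t) (evalVec-subst r ts)

Agree-lift : ∀ {Γ Γ' j} {σ : Subst Γ Γ'} {ρ ρ'} → Agree σ ρ ρ' → (f : FinFun j) →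
  Agree (liftSubst {j = j} σ) (f ∷ ρ) (f ∷ ρ')
Agree-lift {σ = σ} {ρ} {ρ'} r f = agreeing λ where
  (here refl) vs → refl
  (there x) vs → trans (agree r x vs) (cong (λ us → apply⊥ (lookup ρ' (var (σ x))) (us Vec.++ vs))
                             (VecP.map-∘ (atomValue (f ∷ ρ')) there (params (σ x))))

⟦substFormula⟧ : ∀ {Γ Γ'} {σ : Subst Γ Γ'} {ρ ρ'} → Agree σ ρ ρ' → (φ : Formula Γ) →
  ⟦ substFormula σ φ ⟧ ρ' ⇔ ⟦ φ ⟧ ρ
⟦substFormula⟧ r (t ≐ q) = ≡-⇔ (eval-subst r t) (eval-subst r q)
⟦substFormula⟧ r (neg φ) = ¬-cong-⇔ (⟦substFormula⟧ r φ)
⟦substFormula⟧ r (conj φ ψ) = ⟦substFormula⟧ r φ ×-⇔ ⟦substFormula⟧ r ψ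
⟦substFormula⟧ r (disj φ ψ) = ⟦substFormula⟧ r φ ⊎-⇔ ⟦substFormula⟧ r ψ
⟦substFormula⟧ r (impl φ ψ) = →-cong-⇔ (⟦substFormula⟧ r φ) (⟦substFormula⟧ r ψ)
⟦substFormula⟧ r (all k φ) = Π-⇔ λ f → ⟦substFormula⟧ (Agree-lift r f) φ
⟦substFormula⟧ r (ex k φ) = Σ-⇔ λ f → ⟦substFormula⟧ (Agree-lift r f) φ

FO-substFormula : ∀ {Γ Γ'} (σ : Subst Γ Γ') {φ : Formula Γ} → FO φ → FO (substFormula σ φ)
FO-substFormula σ fo-eq = fo-eq
FO-substFormula σ (fo-neg f) = fo-neg (FO-substFormula σ f)
FO-substFormula σ (fo-conj f g) = fo-conj (FO-substFormula σ f) (FO-substFormula σ g)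
FO-substFormula σ (fo-disj f g) = fo-disj (FO-substFormula σ f) (FO-substFormula σ g)
FO-substFormula σ (fo-impl f g) = fo-impl (FO-substFormula σ f) (FO-substFormula σ g)
FO-substFormula σ (fo-all f) = fo-all (FO-substFormula (liftSubst σ) f)
FO-substFormula σ (fo-ex f) = fo-ex (FO-substFormula (liftSubst σ) f)

QF⇒FO : ∀ {Γ} {φ : Formula Γ} → QF φ → FO φ
QF⇒FO qf-eq = fo-eq
QF⇒FO (qf-neg q) = fo-neg (QF⇒FO q)
QF⇒FO (qf-conj q r) = fo-conj (QF⇒FO q) (QF⇒FO r)
QF⇒FO (qf-disj q r) = fo-disj (QF⇒FO q) (QF⇒FO r)
QF⇒FO (qf-impl q r) = fo-impl (QF⇒FO q) (QF⇒FO r)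

rename : ∀ {Γ Γ'} → (∀ {k} → k ∈ Γ → k ∈ Γ') → Subst Γ Γ'
rename r x = target 0 (r x) []

Agree-rename : ∀ {Γ Γ'} (r : ∀ {k} → k ∈ Γ → k ∈ Γ') {ρ : Env Γ} {ρ' : Env Γ'} →
  (∀ {k} (x : k ∈ Γ) → lookup ρ' (r x) ≡ lookup ρ x) → Agree (rename r) ρ ρ'
Agree-rename r h = agreeing λ x vs → cong (λ f → apply⊥ f vs) (sym (h x))

substCase : ∀ {Γ Γ'} (Δ : Ctx) → Subst Δ Γ' → Subst Γ Γ' → Subst (Δ ++ Γ) Γ'
substCase Δ σ τ x = [ σ , τ ] (++⁻ Δ x)

Agree-substCase : ∀ {Γ Γ'} (Δ : Ctx) (σ : Subst Δ Γ') (τ : Subst Γ Γ') {η ρ ρ'} →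
  Agree σ η ρ' → Agree τ ρ ρ' → Agree (substCase Δ σ τ) (++⁺ η ρ) ρ'
Agree-substCase Δ σ τ {η} {ρ} {ρ'} rσ rτ = agreeing pointwise
  where
  pointwise : ∀ {k} x (vs : Vec Atom⊥ k) → apply⊥ (lookup (++⁺ η ρ) x) vs ≡
    apply⊥ (lookup ρ' (var (substCase Δ σ τ x)))
           (Vec.map (atomValue ρ') (params (substCase Δ σ τ x)) Vec.++ vs)
  pointwise x vs rewrite lookup-++⁺ Δ η ρ x with ++⁻ Δ x
  ... | inj₁ y = agree rσ y vs
  ... | inj₂ y = agree rτ y vs

mutual
  eval-≋ : ∀ {Γ} {ρ ρ' : Env Γ} → ρ ≋ ρ' → (t : Term Γ) → eval ρ t ≡ eval ρ' t
  eval-≋ e ω = refl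
  eval-≋ {ρ = ρ} {ρ'} e (app x ts) =
    trans (cong (apply⊥ (lookup ρ x)) (evalVec-≋ e ts)) (≋-apply e x (evalVec ρ' ts))

  evalVec-≋ : ∀ {Γ n} {ρ ρ' : Env Γ} → ρ ≋ ρ' → (ts : Vec (Term Γ) n) → evalVec ρ ts ≡ evalVec ρ' ts
  evalVec-≋ e [] = refl
  evalVec-≋ e (t ∷ ts) = cong₂ _∷_ (eval-≋ e t) (evalVec-≋ e ts)

⟦⟧-≋ : ∀ {Γ} {ρ ρ' : Env Γ} → ρ ≋ ρ' → (φ : Formula Γ) → ⟦ φ ⟧ ρ ⇔ ⟦ φ ⟧ ρ'
⟦⟧-≋ e (t ≐ q) = ≡-⇔ (eval-≋ e t) (eval-≋ e q)
⟦⟧-≋ e (neg φ) = ¬-cong-⇔ (⟦⟧-≋ e φ)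
⟦⟧-≋ e (conj φ ψ) = ⟦⟧-≋ e φ ×-⇔ ⟦⟧-≋ e ψ
⟦⟧-≋ e (disj φ ψ) = ⟦⟧-≋ e φ ⊎-⇔ ⟦⟧-≋ e ψ
⟦⟧-≋ e (impl φ ψ) = →-cong-⇔ (⟦⟧-≋ e φ) (⟦⟧-≋ e ψ)
⟦⟧-≋ e (all k φ) = Π-⇔ λ f → ⟦⟧-≋ (≋-∷ f e) φ
⟦⟧-≋ e (ex k φ) = Σ-⇔ λ f → ⟦⟧-≋ (≋-∷ f e) φ

exMany : ∀ {Γ} (Δ : Ctx) → Formula (Δ ++ Γ) → Formula Γ
exMany [] ψ = ψ
exMany (k ∷ Δ) ψ = exMany Δ (ex k ψ)

⟦exMany⟧ : ∀ {Γ} (Δ : Ctx) (ψ : Formula (Δ ++ Γ)) (ρ : Env Γ) →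
  ⟦ exMany Δ ψ ⟧ ρ ⇔ Σ (Env Δ) λ η → ⟦ ψ ⟧ (++⁺ η ρ)
⟦exMany⟧ [] ψ ρ = mk⇔ (λ h → [] , h) (λ { ([] , h) → h })
⟦exMany⟧ (k ∷ Δ) ψ ρ = ⇔.trans (⟦exMany⟧ Δ (ex k ψ) ρ)
  (mk⇔ (λ (η , f , p) → f ∷ η , p) (λ { (f ∷ η , p) → η , f , p }))

Existential-exMany : ∀ {Γ} (Δ : Ctx) {ψ : Formula (Δ ++ Γ)} → Existential ψ → Existential (exMany Δ ψ)
Existential-exMany [] e = e
Existential-exMany (k ∷ Δ) e = Existential-exMany Δ (ex-ex e)

Atoms : ℕ → Ctx
Atoms k = L.replicate k 0

allAtoms : ∀ {Γ} k → Formula (Atoms k ++ Γ) → Formula Γ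
allAtoms zero φ = φ
allAtoms (suc k) φ = allAtoms k (all 0 φ)

⟦allAtoms⟧ : ∀ {Γ} k (φ : Formula (Atoms k ++ Γ)) (ρ : Env Γ) →
  ⟦ allAtoms k φ ⟧ ρ ⇔ ((η : Env (Atoms k)) → ⟦ φ ⟧ (++⁺ η ρ))
⟦allAtoms⟧ zero φ ρ = mk⇔ (λ { h [] → h }) (λ h → h [])
⟦allAtoms⟧ (suc k) φ ρ = ⇔.trans (⟦allAtoms⟧ k (all 0 φ) ρ)
  (mk⇔ (λ { h (f ∷ η) → h η f }) (λ h η f → h (f ∷ η)))

FO-allAtoms : ∀ {Γ} k {φ : Formula (Atoms k ++ Γ)} → FO φ → FO (allAtoms k φ)
FO-allAtoms zero f = f
FO-allAtoms (suc k) f = FO-allAtoms k (fo-all f)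

atomVars : ∀ {Γ} k → Vec (0 ∈ Atoms k ++ Γ) k
atomVars zero = []
atomVars (suc k) = here refl ∷ Vec.map there (atomVars k)

atomValues : ∀ {k} → Env (Atoms k) → Vec Atom⊥ k
atomValues {zero} [] = []
atomValues {suc k} (f ∷ η) = apply⊥ f [] ∷ atomValues η

atomValues-atomVars : ∀ {Γ} k (η : Env (Atoms k)) (ρ : Env Γ) →
  Vec.map (atomValue (++⁺ η ρ)) (atomVars k) ≡ atomValues η
atomValues-atomVars zero [] ρ = refl
atomValues-atomVars (suc k) (f ∷ η) ρ =
  cong (apply⊥ f [] ∷_) (trans (sym (VecP.map-∘ (atomValue (++⁺ (f ∷ η) ρ)) there (atomVars k)))
                               (atomValues-atomVars k η ρ))

constant : Atom⊥ → FinFun 0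
constant nothing = []
constant (just a) = ([] , a) ∷ []

apply⊥-constant : ∀ v → apply⊥ (constant v) [] ≡ v
apply⊥-constant nothing = refl
apply⊥-constant (just a) = refl

atomEnv : ∀ {k} → Vec Atom⊥ k → Env (Atoms k)
atomEnv [] = []
atomEnv (v ∷ vs) = constant v ∷ atomEnv vs

atomValues-atomEnv : ∀ {k} (vs : Vec Atom⊥ k) → atomValues (atomEnv vs) ≡ vs
atomValues-atomEnv [] = refl
atomValues-atomEnv (v ∷ vs) = cong₂ _∷_ (apply⊥-constant v) (atomValues-atomEnv vs)

applyAtoms : ∀ {Γ k} → k ∈ Γ → Term (Atoms k ++ Γ)
applyAtoms {k = k} z = app (++⁺ʳ (Atoms k) z) (atomTerms (atomVars k))

evalVec-atomVars : ∀ {Γ} k (η : Env (Atoms k)) (ρ : Env Γ) →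
  evalVec (++⁺ η ρ) (atomTerms (atomVars k)) ≡ atomValues η
evalVec-atomVars k η ρ = trans (evalVec-atomTerms (++⁺ η ρ) (atomVars k)) (atomValues-atomVars k η ρ)

eval-applyAtoms : ∀ {Γ k} (z : k ∈ Γ) (η : Env (Atoms k)) (ρ : Env Γ) →
  eval (++⁺ η ρ) (applyAtoms z) ≡ apply⊥ (lookup ρ z) (atomValues η)
eval-applyAtoms {k = k} z η ρ = cong₂ apply⊥ (lookup-++⁺ʳ (Atoms k) η ρ z) (evalVec-atomVars k η ρ)

weaken : ∀ {Γ} k → Subst Γ (Atoms k ++ Γ)
weaken k = rename (++⁺ʳ (Atoms k))

Agree-weaken : ∀ {Γ} k (η : Env (Atoms k)) (ρ : Env Γ) → Agree (weaken k) ρ (++⁺ η ρ)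
Agree-weaken k η ρ = Agree-rename (++⁺ʳ (Atoms k)) (lookup-++⁺ʳ (Atoms k) η ρ)

eval-weaken : ∀ {Γ} k (η : Env (Atoms k)) (ρ : Env Γ) (t : Term Γ) →
  eval (++⁺ η ρ) (substTerm (weaken k) t) ≡ eval ρ t
eval-weaken k η ρ = eval-subst (Agree-weaken k η ρ)

evalVec-weaken : ∀ {Γ n} k (η : Env (Atoms k)) (ρ : Env Γ) (ts : Vec (Term Γ) n) →
  evalVec (++⁺ η ρ) (substTerms (weaken k) ts) ≡ evalVec ρ ts
evalVec-weaken k η ρ = evalVec-subst (Agree-weaken k η ρ)

tautology : ∀ {Γ} → Formula Γ
tautology = ω ≐ ω

allLocations : ∀ {Γ} (V : Vocabulary) → (∀ {k} → k ∈ V → Formula (Atoms k ++ Γ)) → Formula Γ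
allLocations [] b = tautology
allLocations (k ∷ V) b = conj (allAtoms k (b (here refl))) (allLocations V (λ y → b (there y)))

FO-allLocations : ∀ {Γ} (V : Vocabulary) (b : ∀ {k} → k ∈ V → Formula (Atoms k ++ Γ)) →
  (∀ {k} (y : k ∈ V) → FO (b y)) → FO (allLocations V b)
FO-allLocations [] b h = fo-eq
FO-allLocations (k ∷ V) b h =
  fo-conj (FO-allAtoms k (h (here refl))) (FO-allLocations V (λ y → b (there y)) (λ y → h (there y)))

⟦allLocations⟧ : ∀ {Γ} (V : Vocabulary) (b : ∀ {k} → k ∈ V → Formula (Atoms k ++ Γ)) (ρ : Env Γ)
  (Q : ∀ {k} → k ∈ V → Vec Atom⊥ k → Set) →
  (∀ {k} (y : k ∈ V) (η : Env (Atoms k)) → ⟦ b y ⟧ (++⁺ η ρ) ⇔ Q y (atomValues η)) →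
  ⟦ allLocations V b ⟧ ρ ⇔ (∀ {k} (y : k ∈ V) (vs : Vec Atom⊥ k) → Q y vs)
⟦allLocations⟧ [] b ρ Q hb = mk⇔ (λ _ ()) (λ _ → refl)
⟦allLocations⟧ (k ∷ V) b ρ Q hb = mk⇔
  (λ (h₀ , h) → λ { (here refl) vs → head⇒ h₀ vs ; (there y) vs → to tail⇔ h y vs })
  (λ h → from (⟦allAtoms⟧ k (b (here refl)) ρ)
              (λ η → from (hb (here refl) η) (h (here refl) (atomValues η)))
       , from tail⇔ (λ y → h (there y)))
  where
  tail⇔ = ⟦allLocations⟧ V (λ y → b (there y)) ρ (λ y → Q (there y)) (λ y → hb (there y))
  head⇒ : ⟦ allAtoms k (b (here refl)) ⟧ ρ → ∀ vs → Q (here refl) vs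
  head⇒ h₀ vs = subst (Q (here refl)) (atomValues-atomEnv vs)
    (to (hb (here refl) (atomEnv vs)) (to (⟦allAtoms⟧ k (b (here refl)) ρ) h₀ (atomEnv vs)))

∀args⇔∀tuples : ∀ {k} (Q : Vec Atom⊥ k → Set) → (∀ vs → allJust vs ≡ nothing → Q vs) →
  (∀ vs → Q vs) ⇔ (∀ as → Q (Vec.map just as))
∀args⇔∀tuples Q undefined = mk⇔ (λ h as → h (Vec.map just as)) from'
  where
  from' : (∀ as → Q (Vec.map just as)) → ∀ vs → Q vs
  from' h vs with allJust vs in e
  ... | just as = subst Q (sym (allJust≡just⇒ vs e)) (h as)
  ... | nothing = undefined vs e

∀args⇔∀locations : ∀ {V : Vocabulary} (Q : ∀ {k} → k ∈ V → Vec Atom⊥ k → Set) →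
  (∀ {k} (y : k ∈ V) vs → allJust vs ≡ nothing → Q y vs) →
  (∀ {k} (y : k ∈ V) vs → Q y vs) ⇔ (∀ ((k , y , as) : Loc V) → Q y (Vec.map just as))
∀args⇔∀locations Q undefined = mk⇔
  (λ h (k , y , as) → to (∀args⇔∀tuples (Q y) (undefined y)) (h y) as)
  (λ h {k} y → from (∀args⇔∀tuples (Q y) (undefined y)) (λ as → h (k , y , as)))

val-apply⊥ : ∀ {V} (S : Struct V) {k} (y : k ∈ V) (as : Vec Atom k) →
  apply⊥ (lookup S y) (Vec.map just as) ≡ val S (k , y , as)
val-apply⊥ S y as = apply⊥-map-just (lookup S y) as

module _ {V : Vocabulary} where

  old : ∀ {k} → k ∈ V → k ∈ V ++ V
  old = ++⁺ˡ

  new : ∀ {k} → k ∈ V → k ∈ V ++ V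
  new = ++⁺ʳ V

  onOld : Subst V (V ++ V)
  onOld = rename old

  Agree-onOld : (A B : Struct V) → Agree onOld A (++⁺ A B)
  Agree-onOld A B = Agree-rename old (lookup-++⁺ˡ A B)

  eval-onOld : (A B : Struct V) (t : Term V) → eval (++⁺ A B) (substTerm onOld t) ≡ eval A t
  eval-onOld A B = eval-subst (Agree-onOld A B)

  evalVec-onOld : ∀ {n} (A B : Struct V) (ts : Vec (Term V) n) →
    evalVec (++⁺ A B) (substTerms onOld ts) ≡ evalVec A ts
  evalVec-onOld A B = evalVec-subst (Agree-onOld A B)

  eval-old : ∀ {k} (y : k ∈ V) (η : Env (Atoms k)) (A B : Struct V) →
    eval (++⁺ η (++⁺ A B)) (applyAtoms (old y)) ≡ apply⊥ (lookup A y) (atomValues η)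
  eval-old y η A B =
    trans (eval-applyAtoms (old y) η (++⁺ A B)) (cong (λ f → apply⊥ f (atomValues η)) (lookup-++⁺ˡ A B y))

  eval-new : ∀ {k} (y : k ∈ V) (η : Env (Atoms k)) (A B : Struct V) →
    eval (++⁺ η (++⁺ A B)) (applyAtoms (new y)) ≡ apply⊥ (lookup B y) (atomValues η)
  eval-new y η A B =
    trans (eval-applyAtoms (new y) η (++⁺ A B)) (cong (λ f → apply⊥ f (atomValues η)) (lookup-++⁺ʳ V A B y))

  newEqualsOld : ∀ {k} → k ∈ V → Formula (Atoms k ++ (V ++ V))
  newEqualsOld y = applyAtoms (new y) ≐ applyAtoms (old y)

  ⟦newEqualsOld⟧ : ∀ {k} (y : k ∈ V) (η : Env (Atoms k)) (A B : Struct V) →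
    ⟦ newEqualsOld y ⟧ (++⁺ η (++⁺ A B)) ⇔
    (apply⊥ (lookup B y) (atomValues η) ≡ apply⊥ (lookup A y) (atomValues η))
  ⟦newEqualsOld⟧ y η A B = ≡-⇔ (eval-new y η A B) (eval-old y η A B)

  unchanged : Formula (V ++ V)
  unchanged = allLocations V newEqualsOld

  FO-unchanged : FO unchanged
  FO-unchanged = FO-allLocations V _ (λ y → fo-eq)

  ⟦unchanged⟧ : (A B : Struct V) → ⟦ unchanged ⟧ (++⁺ A B) ⇔ Same A B
  ⟦unchanged⟧ A B = ⇔.trans
    (⟦allLocations⟧ V newEqualsOld (++⁺ A B) Q (λ y η → ⟦newEqualsOld⟧ y η A B))
    (⇔.trans (∀args⇔∀locations Q (λ y vs e → trans (apply⊥-undefined _ vs e) (sym (apply⊥-undefined _ vs e))))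
             (Π-⇔ λ (k , y , as) → ≡-⇔ (val-apply⊥ B y as) (val-apply⊥ A y as)))
    where
    Q : ∀ {k} → k ∈ V → Vec Atom⊥ k → Set
    Q y vs = apply⊥ (lookup B y) vs ≡ apply⊥ (lookup A y) vs


cases : ∀ {Γ} → Formula Γ → Formula Γ → Formula Γ → Formula Γ
cases D R S = disj (conj D R) (conj (neg D) S)

cases⇔yes : ∀ {D D' R R' S : Set} → D ⇔ D' → D' → R ⇔ R' → ((D × R) ⊎ (¬ D × S)) ⇔ R'
cases⇔yes D⇔D' d r = mk⇔
  (λ { (inj₁ (_ , x)) → to r x ; (inj₂ (nd , _)) → ⊥-elim (nd (from D⇔D' d)) })
  (λ x → inj₁ (from D⇔D' d , from r x))

cases⇔no : ∀ {D D' R S S' : Set} → D ⇔ D' → ¬ D' → S ⇔ S' → ((D × R) ⊎ (¬ D × S)) ⇔ S'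
cases⇔no D⇔D' nd s = mk⇔
  (λ { (inj₁ (d , _)) → ⊥-elim (nd (to D⇔D' d)) ; (inj₂ (_ , x)) → to s x })
  (λ x → inj₂ ((λ d → nd (to D⇔D' d)) , from s x))

Defined : ∀ {n} → Vec Atom⊥ n → Set
Defined = VAll.All (_≢ nothing)

allJust≡just⇒Defined : ∀ {n} (vs : Vec Atom⊥ n) {as} → allJust vs ≡ just as → Defined vs
allJust≡just⇒Defined vs eq rewrite allJust≡just⇒ vs eq = VAllP.map⁺ (VAll.universal (λ _ ()) _)

allJust≡nothing⇒¬Defined : ∀ {n} (vs : Vec Atom⊥ n) → allJust vs ≡ nothing → ¬ Defined vs
allJust≡nothing⇒¬Defined (nothing ∷ vs) eq (d VAll.∷ _) = d refl
allJust≡nothing⇒¬Defined (just a ∷ vs) eq (_ VAll.∷ ds) with allJust vs in e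
allJust≡nothing⇒¬Defined (just a ∷ vs) () (_ VAll.∷ ds) | just bs
allJust≡nothing⇒¬Defined (just a ∷ vs) eq (_ VAll.∷ ds) | nothing = allJust≡nothing⇒¬Defined vs e ds

defined : ∀ {Γ n} → Vec (Term Γ) n → Formula Γ
defined [] = tautology
defined (t ∷ ts) = conj (neg (t ≐ ω)) (defined ts)

FO-defined : ∀ {Γ n} (ts : Vec (Term Γ) n) → FO (defined ts)
FO-defined [] = fo-eq
FO-defined (t ∷ ts) = fo-conj (fo-neg fo-eq) (FO-defined ts)

⟦defined⟧ : ∀ {Γ n} (ts : Vec (Term Γ) n) (ρ : Env Γ) → ⟦ defined ts ⟧ ρ ⇔ Defined (evalVec ρ ts)
⟦defined⟧ [] ρ = mk⇔ (λ _ → VAll.[]) (λ _ → refl)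
⟦defined⟧ (t ∷ ts) ρ = mk⇔ (λ (d , ds) → d VAll.∷ to (⟦defined⟧ ts ρ) ds)
                             (λ { (d VAll.∷ ds) → d , from (⟦defined⟧ ts ρ) ds })

eqTerms : ∀ {Γ n} → Vec (Term Γ) n → Vec (Term Γ) n → Formula Γ
eqTerms [] [] = tautology
eqTerms (u ∷ us) (w ∷ ws) = conj (u ≐ w) (eqTerms us ws)

FO-eqTerms : ∀ {Γ n} (us ws : Vec (Term Γ) n) → FO (eqTerms us ws)
FO-eqTerms [] [] = fo-eq
FO-eqTerms (u ∷ us) (w ∷ ws) = fo-conj fo-eq (FO-eqTerms us ws)

⟦eqTerms⟧ : ∀ {Γ n} (us ws : Vec (Term Γ) n) (ρ : Env Γ) →
  ⟦ eqTerms us ws ⟧ ρ ⇔ (evalVec ρ us ≡ evalVec ρ ws)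
⟦eqTerms⟧ [] [] ρ = mk⇔ (λ _ → refl) (λ _ → refl)
⟦eqTerms⟧ (u ∷ us) (w ∷ ws) ρ = mk⇔ (λ (e , es) → cong₂ _∷_ e (to (⟦eqTerms⟧ us ws ρ) es))
                                    (λ e → ∷-injectiveˡ e , from (⟦eqTerms⟧ us ws ρ) (∷-injectiveʳ e))

SameIdentifier : ∀ {V : Vocabulary} {k j} → k ∈ V → j ∈ V → Set
SameIdentifier {V} {k} {j} y x = _≡_ {A = Σ ℕ (_∈ V)} (k , y) (j , x)

sameIdentifier? : ∀ {V : Vocabulary} {k j} (y : k ∈ V) (x : j ∈ V) → Dec (SameIdentifier y x)
sameIdentifier? (here refl) (here refl) = yes refl
sameIdentifier? (here refl) (there x) = no (λ ())
sameIdentifier? (there y) (here refl) = no (λ ())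
sameIdentifier? (there y) (there x) with sameIdentifier? y x
... | yes refl = yes refl
... | no ne = no (λ { refl → ne refl })

ElsewhereSame : ∀ {V} → Loc V → Struct V → Struct V → Set
ElsewhereSame ℓ A B = ∀ ℓ' → ℓ' ≢ ℓ → val B ℓ' ≡ val A ℓ'

module _ {V : Vocabulary} {j} (x : j ∈ V) (ts : Vec (Term (V ++ V)) j) where

  private
    unchangedAt : ∀ {k} (y : k ∈ V) → Dec (SameIdentifier y x) → Formula (Atoms k ++ (V ++ V))
    unchangedAt y (yes refl) =
      impl (neg (eqTerms (atomTerms (atomVars j)) (substTerms (weaken j) ts))) (newEqualsOld y)
    unchangedAt y (no _) = newEqualsOld y

  unchangedExcept : Formula (V ++ V)
  unchangedExcept = allLocations V (λ y → unchangedAt y (sameIdentifier? y x))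

  FO-unchangedExcept : FO unchangedExcept
  FO-unchangedExcept = FO-allLocations V _ (λ y → FO-unchangedAt y (sameIdentifier? y x))
    where
    FO-unchangedAt : ∀ {k} (y : k ∈ V) d → FO (unchangedAt y d)
    FO-unchangedAt y (yes refl) = fo-impl (fo-neg (FO-eqTerms _ _)) fo-eq
    FO-unchangedAt y (no _) = fo-eq

  ⟦unchangedExcept⟧ : (as : Vec Atom j) (A B : Struct V) → evalVec (++⁺ A B) ts ≡ Vec.map just as →
    ⟦ unchangedExcept ⟧ (++⁺ A B) ⇔ ElsewhereSame (j , x , as) A B
  ⟦unchangedExcept⟧ as A B ts≡as = ⇔.trans
    (⟦allLocations⟧ V _ (++⁺ A B) Q' (λ y → ⟦unchangedAt⟧ y (sameIdentifier? y x)))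
    (⇔.trans (∀args⇔∀locations Q' (λ y → undefined y (sameIdentifier? y x)))
             (Π-⇔ λ (k , y , bs) → atLocation y bs (sameIdentifier? y x)))
    where
    Unchanged⊥ : ∀ {k} → k ∈ V → Vec Atom⊥ k → Set
    Unchanged⊥ y vs = apply⊥ (lookup B y) vs ≡ apply⊥ (lookup A y) vs

    Q : ∀ {k} (y : k ∈ V) → Dec (SameIdentifier y x) → Vec Atom⊥ k → Set
    Q y (yes refl) vs = vs ≢ Vec.map just as → Unchanged⊥ y vs
    Q y (no _) vs = Unchanged⊥ y vs

    Q' : ∀ {k} → k ∈ V → Vec Atom⊥ k → Set
    Q' y = Q y (sameIdentifier? y x)

    ⟦unchangedAt⟧ : ∀ {k} (y : k ∈ V) d (η : Env (Atoms k)) →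
      ⟦ unchangedAt y d ⟧ (++⁺ η (++⁺ A B)) ⇔ Q y d (atomValues η)
    ⟦unchangedAt⟧ y (yes refl) η = →-cong-⇔
      (¬-cong-⇔ (⇔.trans (⟦eqTerms⟧ _ _ (++⁺ η (++⁺ A B)))
                         (≡-⇔ (evalVec-atomVars j η (++⁺ A B)) (trans (evalVec-weaken j η (++⁺ A B) ts) ts≡as))))
      (⟦newEqualsOld⟧ y η A B)
    ⟦unchangedAt⟧ y (no _) η = ⟦newEqualsOld⟧ y η A B

    undefined : ∀ {k} (y : k ∈ V) d vs → allJust vs ≡ nothing → Q y d vs
    undefined y (yes refl) vs e _ = trans (apply⊥-undefined _ vs e) (sym (apply⊥-undefined _ vs e))
    undefined y (no _) vs e = trans (apply⊥-undefined _ vs e) (sym (apply⊥-undefined _ vs e))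

    atLocation : ∀ {k} (y : k ∈ V) bs d →
      Q y d (Vec.map just bs) ⇔ ((k , y , bs) ≢ (j , x , as) → val B (k , y , bs) ≡ val A (k , y , bs))
    atLocation y bs (yes refl) = →-cong-⇔
      (¬-cong-⇔ (mk⇔ (λ e → cong (λ cs → j , x , cs) (map-just-injective bs as e)) (λ { refl → refl })))
      (≡-⇔ (val-apply⊥ B y bs) (val-apply⊥ A y bs))
    atLocation y bs (no ne) = mk⇔ (λ e _ → to unchanged⇔ e) (λ h → from unchanged⇔ (h λ { refl → ne refl }))
      where unchanged⇔ = ≡-⇔ (val-apply⊥ B y bs) (val-apply⊥ A y bs)

-- Revisions

<∣>-cases : ∀ {f g h a b c : Atom⊥} → f ≡ a → g ≡ b → h ≡ c →
  (((f ≢ nothing) × g ≡ f) ⊎ (f ≡ nothing × g ≡ h)) ⇔ (b ≡ (a <∣> c))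
<∣>-cases {a = just x} refl refl refl =
  mk⇔ (λ { (inj₁ (_ , e)) → e ; (inj₂ (() , _)) }) (λ e → inj₁ ((λ ()) , e))
<∣>-cases {a = nothing} refl refl refl =
  mk⇔ (λ { (inj₁ (n , _)) → ⊥-elim (n refl) ; (inj₂ (_ , e)) → e }) (λ e → inj₂ (refl , e))

module _ {V : Vocabulary} where

  ⟦defined-onOld⟧ : ∀ {n} (A B : Struct V) (ts : Vec (Term V) n) →
    ⟦ defined (substTerms onOld ts) ⟧ (++⁺ A B) ⇔ Defined (evalVec A ts)
  ⟦defined-onOld⟧ A B ts = ⇔.trans (⟦defined⟧ _ (++⁺ A B)) (subst-⇔ Defined (evalVec-onOld A B ts))

  eval-old-onOld : ∀ {k} (x : k ∈ V) (ts : Vec (Term V) k) (A B : Struct V) {as} →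
    allJust (evalVec A ts) ≡ just as →
    eval (++⁺ A B) (app (old x) (substTerms onOld ts)) ≡ val A (k , x , as)
  eval-old-onOld x ts A B e =
    trans (cong₂ apply⊥ (lookup-++⁺ˡ A B x) (evalVec-onOld A B ts)) (apply⊥-defined (lookup A x) (evalVec A ts) e)

  eval-new-onOld : ∀ {k} (x : k ∈ V) (ts : Vec (Term V) k) (A B : Struct V) {as} →
    allJust (evalVec A ts) ≡ just as →
    eval (++⁺ A B) (app (new x) (substTerms onOld ts)) ≡ val B (k , x , as)
  eval-new-onOld x ts A B e =
    trans (cong₂ apply⊥ (lookup-++⁺ʳ V A B x) (evalVec-onOld A B ts)) (apply⊥-defined (lookup B x) (evalVec A ts) e)

  ⟦unchangedExcept-onOld⟧ : ∀ {k} (x : k ∈ V) (ts : Vec (Term V) k) (A B : Struct V) {as} →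
    allJust (evalVec A ts) ≡ just as →
    ⟦ unchangedExcept x (substTerms onOld ts) ⟧ (++⁺ A B) ⇔ ElsewhereSame (k , x , as) A B
  ⟦unchangedExcept-onOld⟧ x ts A B e =
    ⟦unchangedExcept⟧ x _ _ A B (trans (evalVec-onOld A B ts) (allJust≡just⇒ _ e))

  extensionFormula : ∀ {k} → k ∈ V → Vec (Term V) k → Term V → Formula (V ++ V)
  extensionFormula x ts q =
    cases (defined args)
          (conj (disj (conj (neg (Fx ≐ ω)) (Gx ≐ Fx)) (conj (Fx ≐ ω) (Gx ≐ substTerm onOld q)))
                (unchangedExcept x args))
          (unchanged {V})
    where
    args = substTerms onOld ts
    Fx = app (old x) args
    Gx = app (new x) args

  FO-extensionFormula : ∀ {k} (x : k ∈ V) ts q → FO (extensionFormula x ts q)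
  FO-extensionFormula x ts q = fo-disj
    (fo-conj (FO-defined _)
             (fo-conj (fo-disj (fo-conj (fo-neg fo-eq) fo-eq) (fo-conj fo-eq fo-eq)) (FO-unchangedExcept x _)))
    (fo-conj (fo-neg (FO-defined _)) (FO-unchanged {V}))

  ⟦extensionFormula⟧ : ∀ {k} (x : k ∈ V) ts q (A B : Struct V) →
    ⟦ extensionFormula x ts q ⟧ (++⁺ A B) ⇔ ExtendR x ts q A B
  ⟦extensionFormula⟧ x ts q A B with allJust (evalVec A ts) in e
  ... | nothing = cases⇔no (⟦defined-onOld⟧ A B ts) (allJust≡nothing⇒¬Defined _ e) (⟦unchanged⟧ A B)
  ... | just as = cases⇔yes (⟦defined-onOld⟧ A B ts) (allJust≡just⇒Defined _ e)
    (<∣>-cases (eval-old-onOld x ts A B e) (eval-new-onOld x ts A B e) (eval-onOld A B q)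
     ×-⇔ ⟦unchangedExcept-onOld⟧ x ts A B e)

  contractionFormula : ∀ {k} → k ∈ V → Vec (Term V) k → Formula (V ++ V)
  contractionFormula x ts =
    cases (defined args) (conj (app (new x) args ≐ ω) (unchangedExcept x args)) (unchanged {V})
    where args = substTerms onOld ts

  FO-contractionFormula : ∀ {k} (x : k ∈ V) ts → FO (contractionFormula x ts)
  FO-contractionFormula x ts =
    fo-disj (fo-conj (FO-defined _) (fo-conj fo-eq (FO-unchangedExcept x _)))
            (fo-conj (fo-neg (FO-defined _)) (FO-unchanged {V}))

  ⟦contractionFormula⟧ : ∀ {k} (x : k ∈ V) ts (A B : Struct V) →
    ⟦ contractionFormula x ts ⟧ (++⁺ A B) ⇔ ContractR x ts A B
  ⟦contractionFormula⟧ x ts A B with allJust (evalVec A ts) in e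
  ... | nothing = cases⇔no (⟦defined-onOld⟧ A B ts) (allJust≡nothing⇒¬Defined _ e) (⟦unchanged⟧ A B)
  ... | just as = cases⇔yes (⟦defined-onOld⟧ A B ts) (allJust≡just⇒Defined _ e)
    (≡-⇔ (eval-new-onOld x ts A B e) refl ×-⇔ ⟦unchangedExcept-onOld⟧ x ts A B e)

  eval-old-token : (c : 0 ∈ V) (A B : Struct V) → eval (++⁺ A B) (app (old c) []) ≡ val A (0 , c , [])
  eval-old-token c A B = cong (λ f → apply⊥ f []) (lookup-++⁺ˡ A B c)

  eval-new-token : (c : 0 ∈ V) (A B : Struct V) → eval (++⁺ A B) (app (new c) []) ≡ val B (0 , c , [])
  eval-new-token c A B = cong (λ f → apply⊥ f []) (lookup-++⁺ʳ V A B c)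

distinctFrom : ∀ {Γ n} → Vec (Term Γ) n → Term Γ → Formula Γ
distinctFrom [] t = tautology
distinctFrom (u ∷ us) t = conj (neg (u ≐ t)) (distinctFrom us t)

FO-distinctFrom : ∀ {Γ n} (us : Vec (Term Γ) n) t → FO (distinctFrom us t)
FO-distinctFrom [] t = fo-eq
FO-distinctFrom (u ∷ us) t = fo-conj (fo-neg fo-eq) (FO-distinctFrom us t)

⟦distinctFrom⟧ : ∀ {Γ n} (us : Vec (Term Γ) n) t (ρ : Env Γ) →
  ⟦ distinctFrom us t ⟧ ρ ⇔ VAll.All (_≢ eval ρ t) (evalVec ρ us)
⟦distinctFrom⟧ [] t ρ = mk⇔ (λ _ → VAll.[]) (λ _ → refl)
⟦distinctFrom⟧ (u ∷ us) t ρ = mk⇔ (λ (d , ds) → d VAll.∷ to (⟦distinctFrom⟧ us t ρ) ds)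
                                  (λ { (d VAll.∷ ds) → d , from (⟦distinctFrom⟧ us t ρ) ds })

All≢just⇔∉ : ∀ {n} (bs : Vec Atom n) a → VAll.All (_≢ just a) (Vec.map just bs) ⇔ (¬ VecMem._∈_ a bs)
All≢just⇔∉ [] a = mk⇔ (λ _ ()) (λ _ → VAll.[])
All≢just⇔∉ (b ∷ bs) a = mk⇔
  (λ { (n VAll.∷ ns) (VAny.here refl) → n refl ; (n VAll.∷ ns) (VAny.there m) → to (All≢just⇔∉ bs a) ns m })
  (λ h → (λ e → h (VAny.here (sym (just-injective e)))) VAll.∷ from (All≢just⇔∉ bs a) (λ m → h (VAny.there m)))

FreshAt : ∀ {V} → Struct V → Atom → Loc V → Set
FreshAt S a ℓ = val S ℓ ≢ nothing → ¬ VecMem._∈_ a (proj₂ (proj₂ ℓ)) × val S ℓ ≢ just a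

FreshAt⇔¬InScope : ∀ {V} (S : Struct V) a → (∀ ℓ → FreshAt S a ℓ) ⇔ (¬ InScope S a)
FreshAt⇔¬InScope S a = mk⇔ to' from'
  where
  to' : (∀ ℓ → FreshAt S a ℓ) → ¬ InScope S a
  to' h (ℓ , b , vb , inj₁ mem) = proj₁ (h ℓ (λ e → just≢nothing (trans (sym vb) e))) mem
  to' h (ℓ , b , vb , inj₂ refl) = proj₂ (h ℓ (λ e → just≢nothing (trans (sym vb) e))) vb
  from' : ¬ InScope S a → ∀ ℓ → FreshAt S a ℓ
  from' n ℓ defined with val S ℓ in e
  ... | nothing = ⊥-elim (defined refl)
  ... | just b = (λ mem → n (ℓ , b , e , inj₁ mem)) , (λ { refl → n (ℓ , b , e , inj₂ refl) })

module _ {V : Vocabulary} where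

  freshAt : ∀ {k} → 0 ∈ V → k ∈ V → Formula (Atoms k ++ (V ++ V))
  freshAt {k} c y =
    impl (neg (applyAtoms (old y) ≐ ω))
         (conj (distinctFrom (atomTerms (atomVars k)) c') (neg (applyAtoms (old y) ≐ c')))
    where c' = substTerm (weaken k) (app (new c) [])

  fresh : 0 ∈ V → Formula (V ++ V)
  fresh c = allLocations V (freshAt c)

  FO-fresh : (c : 0 ∈ V) → FO (fresh c)
  FO-fresh c = FO-allLocations V _ (λ y → fo-impl (fo-neg fo-eq) (fo-conj (FO-distinctFrom _ _) (fo-neg fo-eq)))

  ⟦fresh⟧ : (c : 0 ∈ V) (A B : Struct V) {a : Atom} → val B (0 , c , []) ≡ just a →
    ⟦ fresh c ⟧ (++⁺ A B) ⇔ (¬ InScope A a)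
  ⟦fresh⟧ c A B {a} c≡a = ⇔.trans (⟦allLocations⟧ V (freshAt c) (++⁺ A B) Q ⟦freshAt⟧)
    (⇔.trans (∀args⇔∀locations Q (λ y vs e nd → ⊥-elim (nd (apply⊥-undefined _ vs e))))
    (⇔.trans (Π-⇔ λ (k , y , bs) → →-cong-⇔ (¬-cong-⇔ (≡-⇔ (val-apply⊥ A y bs) refl))
                                             (All≢just⇔∉ bs a ×-⇔ ¬-cong-⇔ (≡-⇔ (val-apply⊥ A y bs) refl)))
             (FreshAt⇔¬InScope A a)))
    where
    Q : ∀ {k} → k ∈ V → Vec Atom⊥ k → Set
    Q y vs = apply⊥ (lookup A y) vs ≢ nothing → VAll.All (_≢ just a) vs × apply⊥ (lookup A y) vs ≢ just a

    ⟦freshAt⟧ : ∀ {k} (y : k ∈ V) (η : Env (Atoms k)) →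
      ⟦ freshAt c y ⟧ (++⁺ η (++⁺ A B)) ⇔ Q y (atomValues η)
    ⟦freshAt⟧ {k} y η = →-cong-⇔ (¬-cong-⇔ (≡-⇔ old≡ refl))
      (⇔.trans (⟦distinctFrom⟧ _ _ ρ)
               (subst₂-⇔ (λ vs w → VAll.All (_≢ w) vs) (evalVec-atomVars k η (++⁺ A B)) c'≡a)
       ×-⇔ ¬-cong-⇔ (≡-⇔ old≡ c'≡a))
      where
      ρ = ++⁺ η (++⁺ A B)
      old≡ = eval-old y η A B
      c'≡a = trans (eval-weaken k η (++⁺ A B) (app (new c) [])) (trans (eval-new-token c A B) c≡a)

  inceptionFormula : 0 ∈ V → Formula (V ++ V)
  inceptionFormula c = cases (app (old c) [] ≐ ω)
    (conj (neg (app (new c) [] ≐ ω)) (conj (fresh c) (unchangedExcept c [])))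
    (unchanged {V})

  FO-inceptionFormula : (c : 0 ∈ V) → FO (inceptionFormula c)
  FO-inceptionFormula c =
    fo-disj (fo-conj fo-eq (fo-conj (fo-neg fo-eq) (fo-conj (FO-fresh c) (FO-unchangedExcept c []))))
            (fo-conj (fo-neg fo-eq) (FO-unchanged {V}))

  ⟦inceptionFormula⟧ : (c : 0 ∈ V) (A B : Struct V) → ⟦ inceptionFormula c ⟧ (++⁺ A B) ⇔ InceptR c A B
  ⟦inceptionFormula⟧ c A B with val A (0 , c , []) in c≡
  ... | just _ = cases⇔no (≡-⇔ (trans (eval-old-token c A B) c≡) refl) (λ ()) (⟦unchanged⟧ A B)
  ... | nothing = cases⇔yes (≡-⇔ (trans (eval-old-token c A B) c≡) refl) refl (mk⇔ to' from')
    where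
    newAtom = conj (neg (app (new c) [] ≐ ω)) (conj (fresh c) (unchangedExcept c []))
    unchangedExcept⇔ = ⟦unchangedExcept⟧ c [] [] A B refl

    to' : ⟦ newAtom ⟧ (++⁺ A B) → Σ Atom λ a → ¬ InScope A a × Update (0 , c , []) (just a) A B
    to' (defined , isFresh , others) with val B (0 , c , []) in c≡a
    ... | nothing = ⊥-elim (defined (trans (eval-new-token c A B) c≡a))
    ... | just a = a , to (⟦fresh⟧ c A B c≡a) isFresh , refl , to unchangedExcept⇔ others

    from' : (Σ Atom λ a → ¬ InScope A a × Update (0 , c , []) (just a) A B) → ⟦ newAtom ⟧ (++⁺ A B)
    from' (a , notInScope , c≡a , others) =
      (λ e → just≢nothing (trans (sym c≡a) (trans (sym (eval-new-token c A B)) e)))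
      , from (⟦fresh⟧ c A B c≡a) notInScope , from unchangedExcept⇔ others

DeletedAt : Atom⊥ → Atom⊥ → Atom⊥ → Set
DeletedAt c u w = (u ≡ c → w ≡ nothing) × (u ≢ c → w ≡ u)

module _ {V : Vocabulary} where

  deletedAt : ∀ {k} → 0 ∈ V → k ∈ V → Formula (Atoms k ++ (V ++ V))
  deletedAt {k} c y = conj (impl (applyAtoms (old y) ≐ c') (applyAtoms (new y) ≐ ω))
                           (impl (neg (applyAtoms (old y) ≐ c')) (newEqualsOld y))
    where c' = substTerm (weaken k) (app (old c) [])

  deletionFormula : 0 ∈ V → Formula (V ++ V)
  deletionFormula c = cases (neg (app (old c) [] ≐ ω)) (allLocations V (deletedAt c)) (unchanged {V})

  FO-deletionFormula : (c : 0 ∈ V) → FO (deletionFormula c)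
  FO-deletionFormula c = fo-disj
    (fo-conj (fo-neg fo-eq)
             (FO-allLocations V _ (λ y → fo-conj (fo-impl fo-eq fo-eq) (fo-impl (fo-neg fo-eq) fo-eq))))
    (fo-conj (fo-neg (fo-neg fo-eq)) (FO-unchanged {V}))

  ⟦deletionFormula⟧ : (c : 0 ∈ V) (A B : Struct V) → ⟦ deletionFormula c ⟧ (++⁺ A B) ⇔ DeleteR c A B
  ⟦deletionFormula⟧ c A B with val A (0 , c , []) in c≡
  ... | nothing =
    cases⇔no (¬-cong-⇔ (≡-⇔ (trans (eval-old-token c A B) c≡) refl)) (λ n → n refl) (⟦unchanged⟧ A B)
  ... | just a = cases⇔yes (¬-cong-⇔ (≡-⇔ (trans (eval-old-token c A B) c≡) refl)) (λ ())
    (⇔.trans (⟦allLocations⟧ V (deletedAt c) (++⁺ A B) Q ⟦deletedAt⟧)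
    (⇔.trans (∀args⇔∀locations Q (λ y vs e → (λ _ → apply⊥-undefined _ vs e)
                                            , (λ _ → trans (apply⊥-undefined _ vs e) (sym (apply⊥-undefined _ vs e)))))
             (Π-⇔ λ (k , y , bs) → subst₂-⇔ (DeletedAt (just a)) (val-apply⊥ A y bs) (val-apply⊥ B y bs))))
    where
    Q : ∀ {k} → k ∈ V → Vec Atom⊥ k → Set
    Q y vs = DeletedAt (just a) (apply⊥ (lookup A y) vs) (apply⊥ (lookup B y) vs)

    ⟦deletedAt⟧ : ∀ {k} (y : k ∈ V) (η : Env (Atoms k)) →
      ⟦ deletedAt c y ⟧ (++⁺ η (++⁺ A B)) ⇔ Q y (atomValues η)
    ⟦deletedAt⟧ {k} y η = ⇔.trans
      (subst-⇔ (λ c'' → DeletedAt c'' _ _)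
               (trans (eval-weaken k η (++⁺ A B) (app (old c) [])) (trans (eval-old-token c A B) c≡)))
      (subst₂-⇔ (DeletedAt (just a)) (eval-old y η A B) (eval-new y η A B))

-- Capturing programs

record Capture {V : Vocabulary} (P : Prog V) : Set where
  field
    Δ        : Ctx
    ψ        : Formula (Δ ++ (V ++ V))
    ψ-FO     : FO ψ
    sound    : ∀ (A B : Struct V) → Yields P A B → Σ (Env Δ) λ η → ⟦ ψ ⟧ (++⁺ η (++⁺ A B))
    complete : ∀ (A B : Struct V) (η : Env Δ) → ⟦ ψ ⟧ (++⁺ η (++⁺ A B)) → Yields P A B

captureFO : ∀ {V : Vocabulary} {P : Prog V} (φ : Formula (V ++ V)) → FO φ →
  (∀ A B → ⟦ φ ⟧ (++⁺ A B) ⇔ Yields P A B) → Capture P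
captureFO φ φ-FO φ⇔ = record
  { Δ = [] ; ψ = φ ; ψ-FO = φ-FO
  ; sound = λ A B y → [] , from (φ⇔ A B) y
  ; complete = λ { A B [] h → to (φ⇔ A B) h } }

module _ {V : Vocabulary} where

  capture-extend : ∀ {k} (x : k ∈ V) ts q → Capture (extend x ts q)
  capture-extend x ts q = captureFO (extensionFormula x ts q) (FO-extensionFormula x ts q)
    λ A B → ⇔.trans (⟦extensionFormula⟧ x ts q A B) (mk⇔ y-extend λ { (y-extend r) → r })

  capture-contract : ∀ {k} (x : k ∈ V) ts → Capture (contract x ts)
  capture-contract x ts = captureFO (contractionFormula x ts) (FO-contractionFormula x ts)
    λ A B → ⇔.trans (⟦contractionFormula⟧ x ts A B) (mk⇔ y-contract λ { (y-contract r) → r })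

  capture-incept : (c : 0 ∈ V) → Capture (incept c)
  capture-incept c = captureFO (inceptionFormula c) (FO-inceptionFormula c)
    λ A B → ⇔.trans (⟦inceptionFormula⟧ c A B) (mk⇔ y-incept λ { (y-incept r) → r })

  capture-delete : (c : 0 ∈ V) → Capture (delete c)
  capture-delete c = captureFO (deletionFormula c) (FO-deletionFormula c)
    λ A B → ⇔.trans (⟦deletionFormula⟧ c A B) (mk⇔ y-delete λ { (y-delete r) → r })

module Sequence {V : Vocabulary} {P Q : Prog V} (capP : Capture P) (capQ : Capture Q) where
  open Capture capP renaming (Δ to Δp; ψ to ψp; ψ-FO to ψp-FO; sound to soundP; complete to completeP)
  open Capture capQ renaming (Δ to Δq; ψ to ψq; ψ-FO to ψq-FO; sound to soundQ; complete to completeQ)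

  Δ : Ctx
  Δ = V ++ (Δp ++ Δq)

  private
    mid start end : ∀ {k} → k ∈ V → k ∈ Δ ++ (V ++ V)
    mid y = ++⁺ˡ (++⁺ˡ y)
    start y = ++⁺ʳ Δ (++⁺ˡ y)
    end y = ++⁺ʳ Δ (++⁺ʳ V y)

    witnessP : ∀ {k} → k ∈ Δp → k ∈ Δ ++ (V ++ V)
    witnessP x = ++⁺ˡ (++⁺ʳ V (++⁺ˡ x))

    witnessQ : ∀ {k} → k ∈ Δq → k ∈ Δ ++ (V ++ V)
    witnessQ x = ++⁺ˡ (++⁺ʳ V (++⁺ʳ Δp x))

    σP : Subst (Δp ++ (V ++ V)) (Δ ++ (V ++ V))
    σP = substCase Δp (rename witnessP) (substCase V (rename start) (rename mid))

    σQ : Subst (Δq ++ (V ++ V)) (Δ ++ (V ++ V))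
    σQ = substCase Δq (rename witnessQ) (substCase V (rename mid) (rename end))

  ψ : Formula (Δ ++ (V ++ V))
  ψ = conj (substFormula σP ψp) (substFormula σQ ψq)

  module _ (M : Struct V) (ηp : Env Δp) (ηq : Env Δq) (A B : Struct V) where
    private
      η = ++⁺ M (++⁺ ηp ηq)
      ρ = ++⁺ η (++⁺ A B)

      lookup-mid : ∀ {k} (y : k ∈ V) → lookup ρ (mid y) ≡ lookup M y
      lookup-mid y = trans (lookup-++⁺ˡ η (++⁺ A B) (++⁺ˡ y)) (lookup-++⁺ˡ M (++⁺ ηp ηq) y)

      lookup-start : ∀ {k} (y : k ∈ V) → lookup ρ (start y) ≡ lookup A y
      lookup-start y = trans (lookup-++⁺ʳ Δ η (++⁺ A B) (++⁺ˡ y)) (lookup-++⁺ˡ A B y)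

      lookup-end : ∀ {k} (y : k ∈ V) → lookup ρ (end y) ≡ lookup B y
      lookup-end y = trans (lookup-++⁺ʳ Δ η (++⁺ A B) (++⁺ʳ V y)) (lookup-++⁺ʳ V A B y)

      lookup-witnessP : ∀ {k} (x : k ∈ Δp) → lookup ρ (witnessP x) ≡ lookup ηp x
      lookup-witnessP x = trans (lookup-++⁺ˡ η (++⁺ A B) (++⁺ʳ V (++⁺ˡ x)))
                                (trans (lookup-++⁺ʳ V M (++⁺ ηp ηq) (++⁺ˡ x)) (lookup-++⁺ˡ ηp ηq x))

      lookup-witnessQ : ∀ {k} (x : k ∈ Δq) → lookup ρ (witnessQ x) ≡ lookup ηq x
      lookup-witnessQ x = trans (lookup-++⁺ˡ η (++⁺ A B) (++⁺ʳ V (++⁺ʳ Δp x)))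
                                (trans (lookup-++⁺ʳ V M (++⁺ ηp ηq) (++⁺ʳ Δp x)) (lookup-++⁺ʳ Δp ηp ηq x))

    ψP⇔ : ⟦ substFormula σP ψp ⟧ ρ ⇔ ⟦ ψp ⟧ (++⁺ ηp (++⁺ A M))
    ψP⇔ = ⟦substFormula⟧ {ρ = ++⁺ ηp (++⁺ A M)} agreement ψp
      where
      agreement = Agree-substCase Δp _ (substCase V (rename start) (rename mid)) {ηp} {++⁺ A M}
        (Agree-rename witnessP lookup-witnessP)
        (Agree-substCase V (rename start) (rename mid) {A} {M} (Agree-rename start lookup-start) (Agree-rename mid lookup-mid))

    ψQ⇔ : ⟦ substFormula σQ ψq ⟧ ρ ⇔ ⟦ ψq ⟧ (++⁺ ηq (++⁺ M B))
    ψQ⇔ = ⟦substFormula⟧ {ρ = ++⁺ ηq (++⁺ M B)} agreement ψq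
      where
      agreement = Agree-substCase Δq _ (substCase V (rename mid) (rename end)) {ηq} {++⁺ M B}
        (Agree-rename witnessQ lookup-witnessQ)
        (Agree-substCase V (rename mid) (rename end) {M} {B} (Agree-rename mid lookup-mid) (Agree-rename end lookup-end))

  capture : Capture (P ⨾ Q)
  capture = record
    { Δ = Δ ; ψ = ψ ; ψ-FO = fo-conj (FO-substFormula σP ψp-FO) (FO-substFormula σQ ψq-FO)
    ; sound = sound ; complete = complete }
    where
    sound : ∀ (A B : Struct V) → Yields (P ⨾ Q) A B → Σ (Env Δ) λ η → ⟦ ψ ⟧ (++⁺ η (++⁺ A B))
    sound A B (y-seq {S₁ = M} yP yQ) =
      let (ηp , hp) = soundP A M yP ; (ηq , hq) = soundQ M B yQ in
      ++⁺ M (++⁺ ηp ηq) , from (ψP⇔ M ηp ηq A B) hp , from (ψQ⇔ M ηp ηq A B) hq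

    complete : ∀ (A B : Struct V) (η : Env Δ) → ⟦ ψ ⟧ (++⁺ η (++⁺ A B)) → Yields (P ⨾ Q) A B
    complete A B η (hp , hq) with ++⁺-surjective V η
    ... | M , η' , refl with ++⁺-surjective Δp η'
    ... | ηp , ηq , refl =
      y-seq (completeP A M ηp (to (ψP⇔ M ηp ηq A B) hp)) (completeQ M B ηq (to (ψQ⇔ M ηp ηq A B) hq))

module Branch {V : Vocabulary} (G : Formula V) (g : QF G) {P Q : Prog V} (capP : Capture P) (capQ : Capture Q) where
  open Capture capP renaming (Δ to Δp; ψ to ψp; ψ-FO to ψp-FO; sound to soundP; complete to completeP)
  open Capture capQ renaming (Δ to Δq; ψ to ψq; ψ-FO to ψq-FO; sound to soundQ; complete to completeQ)

  Δ : Ctx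
  Δ = Δp ++ Δq

  private
    witnessP : ∀ {k} → k ∈ Δp → k ∈ Δ ++ (V ++ V)
    witnessP x = ++⁺ˡ (++⁺ˡ x)

    witnessQ : ∀ {k} → k ∈ Δq → k ∈ Δ ++ (V ++ V)
    witnessQ x = ++⁺ˡ (++⁺ʳ Δp x)

    σG : Subst V (Δ ++ (V ++ V))
    σG = rename (λ y → ++⁺ʳ Δ (++⁺ˡ y))

    σP : Subst (Δp ++ (V ++ V)) (Δ ++ (V ++ V))
    σP = substCase Δp (rename witnessP) (rename (++⁺ʳ Δ))

    σQ : Subst (Δq ++ (V ++ V)) (Δ ++ (V ++ V))
    σQ = substCase Δq (rename witnessQ) (rename (++⁺ʳ Δ))

  ψ : Formula (Δ ++ (V ++ V))
  ψ = cases (substFormula σG G) (substFormula σP ψp) (substFormula σQ ψq)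

  module _ (ηp : Env Δp) (ηq : Env Δq) (A B : Struct V) where
    private
      η = ++⁺ ηp ηq
      ρ = ++⁺ η (++⁺ A B)
      pair : Agree (rename (++⁺ʳ Δ)) (++⁺ A B) ρ
      pair = Agree-rename (++⁺ʳ Δ) (lookup-++⁺ʳ Δ η (++⁺ A B))

    G⇔ : ⟦ substFormula σG G ⟧ ρ ⇔ ⟦ G ⟧ A
    G⇔ = ⟦substFormula⟧ {ρ' = ρ}
      (Agree-rename _ λ y → trans (lookup-++⁺ʳ Δ η (++⁺ A B) (++⁺ˡ y)) (lookup-++⁺ˡ A B y)) G

    ψP⇔ : ⟦ substFormula σP ψp ⟧ ρ ⇔ ⟦ ψp ⟧ (++⁺ ηp (++⁺ A B))
    ψP⇔ = ⟦substFormula⟧ {ρ' = ρ} (Agree-substCase Δp (rename witnessP) (rename (++⁺ʳ Δ)) {ηp} {++⁺ A B}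
      (Agree-rename _ λ x → trans (lookup-++⁺ˡ η (++⁺ A B) (++⁺ˡ x)) (lookup-++⁺ˡ ηp ηq x)) pair) ψp

    ψQ⇔ : ⟦ substFormula σQ ψq ⟧ ρ ⇔ ⟦ ψq ⟧ (++⁺ ηq (++⁺ A B))
    ψQ⇔ = ⟦substFormula⟧ {ρ' = ρ} (Agree-substCase Δq (rename witnessQ) (rename (++⁺ʳ Δ)) {ηq} {++⁺ A B}
      (Agree-rename _ λ x → trans (lookup-++⁺ˡ η (++⁺ A B) (++⁺ʳ Δp x)) (lookup-++⁺ʳ Δp ηp ηq x)) pair) ψq

  capture : Capture (ifte G g P Q)
  capture = record
    { Δ = Δ ; ψ = ψ
    ; ψ-FO = fo-disj (fo-conj G-FO (FO-substFormula σP ψp-FO)) (fo-conj (fo-neg G-FO) (FO-substFormula σQ ψq-FO))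
    ; sound = sound ; complete = complete }
    where
    G-FO = FO-substFormula σG (QF⇒FO g)

    sound : ∀ (A B : Struct V) → Yields (ifte G g P Q) A B → Σ (Env Δ) λ η → ⟦ ψ ⟧ (++⁺ η (++⁺ A B))
    sound A B (y-ifT holds yP) =
      let (ηp , hp) = soundP A B yP ; ηq = emptyEnv Δq in
      ++⁺ ηp ηq , inj₁ (from (G⇔ ηp ηq A B) holds , from (ψP⇔ ηp ηq A B) hp)
    sound A B (y-ifF fails yQ) =
      let (ηq , hq) = soundQ A B yQ ; ηp = emptyEnv Δp in
      ++⁺ ηp ηq , inj₂ (from (¬-cong-⇔ (G⇔ ηp ηq A B)) fails , from (ψQ⇔ ηp ηq A B) hq)

    complete : ∀ (A B : Struct V) (η : Env Δ) → ⟦ ψ ⟧ (++⁺ η (++⁺ A B)) → Yields (ifte G g P Q) A B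
    complete A B η h with ++⁺-surjective Δp η
    complete A B η (inj₁ (holds , hp)) | ηp , ηq , refl =
      y-ifT (to (G⇔ ηp ηq A B) holds) (completeP A B ηp (to (ψP⇔ ηp ηq A B) hp))
    complete A B η (inj₂ (fails , hq)) | ηp , ηq , refl =
      y-ifF (to (¬-cong-⇔ (G⇔ ηp ηq A B)) fails) (completeQ A B ηq (to (ψQ⇔ ηp ηq A B) hq))

-- Iteration

sucs : Ctx → Ctx
sucs = L.map suc

suc∈ : ∀ {X : Ctx} {k} → k ∈ X → suc k ∈ sucs X
suc∈ (here refl) = here refl
suc∈ (there x) = there (suc∈ x)

sectionEnv : ∀ {X : Ctx} → Env (sucs X) → Atom⊥ → Env X
sectionEnv {[]} [] v = []
sectionEnv {k ∷ X} (H ∷ W) v = section⊥ H v ∷ sectionEnv W v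

sectionAt : ∀ {X : Ctx} → Env (sucs X) → ℕ → Env X
sectionAt W n = sectionEnv W (just n)

apply⊥-sectionEnv : ∀ {X : Ctx} (W : Env (sucs X)) v {k} (x : k ∈ X) vs →
  apply⊥ (lookup (sectionEnv W v) x) vs ≡ apply⊥ (lookup W (suc∈ x)) (v ∷ vs)
apply⊥-sectionEnv (H ∷ W) v (here refl) vs = apply⊥-section⊥ H v vs
apply⊥-sectionEnv (H ∷ W) v (there x) vs = apply⊥-sectionEnv W v x vs

sectionEnv-emptyEnv : ∀ (X : Ctx) v → sectionEnv (emptyEnv (sucs X)) v ≋ emptyEnv X
sectionEnv-emptyEnv X v = ≋-intro λ x vs → begin
  apply⊥ (lookup (sectionEnv (emptyEnv (sucs X)) v) x) vs
    ≡⟨ apply⊥-sectionEnv (emptyEnv (sucs X)) v x vs ⟩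
  apply⊥ (lookup (emptyEnv (sucs X)) (suc∈ x)) (v ∷ vs)
    ≡⟨ cong (λ f → apply⊥ f (v ∷ vs)) (lookup-emptyEnv (sucs X) (suc∈ x)) ⟩
  apply⊥ [] (v ∷ vs)
    ≡⟨ apply⊥-[] (v ∷ vs) ⟩
  nothing
    ≡⟨ apply⊥-[] vs ⟨
  apply⊥ [] vs
    ≡⟨ cong (λ f → apply⊥ f vs) (lookup-emptyEnv X x) ⟨
  apply⊥ (lookup (emptyEnv X) x) vs ∎
  where open ≡-Reasoning

graftEnv : ∀ {X : Ctx} → Atom → Env X → Env (sucs X) → Env (sucs X)
graftEnv {[]} a [] [] = []
graftEnv {k ∷ X} a (f ∷ E) (H ∷ W) = (graft a f ++ H) ∷ graftEnv a E W

lookup-graftEnv : ∀ {X : Ctx} a (E : Env X) (W : Env (sucs X)) {k} (x : k ∈ X) →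
  lookup (graftEnv a E W) (suc∈ x) ≡ graft a (lookup E x) ++ lookup W (suc∈ x)
lookup-graftEnv a (f ∷ E) (H ∷ W) (here refl) = refl
lookup-graftEnv a (f ∷ E) (H ∷ W) (there x) = lookup-graftEnv a E W x

apply⊥-graft-++-same : ∀ {k} (f : FinFun k) (w : FinFun (suc k)) a vs →
  apply⊥ w (just a ∷ vs) ≡ nothing → apply⊥ (graft a f ++ w) (just a ∷ vs) ≡ apply⊥ f vs
apply⊥-graft-++-same f w a vs unused with allJust vs
... | just as =
  trans (apply-graft-++-same f w a as) (trans (cong (apply f as <∣>_) unused) (<∣>-identityʳ (apply f as)))
... | nothing = refl

apply⊥-graft-++-other : ∀ {k} (f : FinFun k) (w : FinFun (suc k)) a b vs → a ≢ b →
  apply⊥ (graft a f ++ w) (just b ∷ vs) ≡ apply⊥ w (just b ∷ vs)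
apply⊥-graft-++-other f w a b vs a≢b with allJust vs
... | just as = apply-graft-++-other f w a b as a≢b
... | nothing = refl

sectionEnv-graftEnv-same : ∀ {X : Ctx} a (E : Env X) (W : Env (sucs X)) →
  sectionEnv W (just a) ≋ emptyEnv X → sectionEnv (graftEnv a E W) (just a) ≋ E
sectionEnv-graftEnv-same {X} a E W unused = ≋-intro λ x vs → begin
  apply⊥ (lookup (sectionEnv (graftEnv a E W) (just a)) x) vs
    ≡⟨ apply⊥-sectionEnv (graftEnv a E W) (just a) x vs ⟩
  apply⊥ (lookup (graftEnv a E W) (suc∈ x)) (just a ∷ vs)
    ≡⟨ cong (λ f → apply⊥ f (just a ∷ vs)) (lookup-graftEnv a E W x) ⟩
  apply⊥ (graft a (lookup E x) ++ lookup W (suc∈ x)) (just a ∷ vs)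
    ≡⟨ apply⊥-graft-++-same (lookup E x) _ a vs (unused-at x vs) ⟩
  apply⊥ (lookup E x) vs ∎
  where
  open ≡-Reasoning
  unused-at : ∀ {k} (x : k ∈ X) vs → apply⊥ (lookup W (suc∈ x)) (just a ∷ vs) ≡ nothing
  unused-at x vs = trans (sym (apply⊥-sectionEnv W (just a) x vs))
    (trans (≋-apply unused x vs) (trans (cong (λ f → apply⊥ f vs) (lookup-emptyEnv X x)) (apply⊥-[] vs)))

sectionEnv-graftEnv-other : ∀ {X : Ctx} a b (E : Env X) (W : Env (sucs X)) → a ≢ b →
  sectionEnv (graftEnv a E W) (just b) ≋ sectionEnv W (just b)
sectionEnv-graftEnv-other a b E W a≢b = ≋-intro λ x vs → begin
  apply⊥ (lookup (sectionEnv (graftEnv a E W) (just b)) x) vs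
    ≡⟨ apply⊥-sectionEnv (graftEnv a E W) (just b) x vs ⟩
  apply⊥ (lookup (graftEnv a E W) (suc∈ x)) (just b ∷ vs)
    ≡⟨ cong (λ f → apply⊥ f (just b ∷ vs)) (lookup-graftEnv a E W x) ⟩
  apply⊥ (graft a (lookup E x) ++ lookup W (suc∈ x)) (just b ∷ vs)
    ≡⟨ apply⊥-graft-++-other (lookup E x) _ a b vs a≢b ⟩
  apply⊥ (lookup W (suc∈ x)) (just b ∷ vs)
    ≡⟨ apply⊥-sectionEnv W (just b) x vs ⟨
  apply⊥ (lookup (sectionEnv W (just b)) x) vs ∎
  where open ≡-Reasoning

sectionSubst : ∀ {X Γ : Ctx} → 0 ∈ Γ → (∀ {k} → k ∈ X → suc k ∈ Γ) → Subst X Γ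
sectionSubst p r x = target 1 (r x) (p ∷ [])

Agree-sectionSubst : ∀ {X Γ : Ctx} (p : 0 ∈ Γ) (r : ∀ {k} → k ∈ X → suc k ∈ Γ) (W : Env (sucs X))
  {ρ : Env Γ} {v} → (∀ {k} (x : k ∈ X) → lookup ρ (r x) ≡ lookup W (suc∈ x)) → atomValue ρ p ≡ v →
  Agree (sectionSubst p r) (sectionEnv W v) ρ
Agree-sectionSubst p r W {ρ} {v} lookup-r p≡v = agreeing λ x vs →
  trans (apply⊥-sectionEnv W v x vs) (cong₂ (λ f w → apply⊥ f (w ∷ vs)) (sym (lookup-r x)) (sym p≡v))

removeKey : Atom → FinFun 1 → FinFun 1
removeKey z [] = []
removeKey z ((u , v) ∷ es) with ≡-dec ℕ._≟_ u (z ∷ [])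
... | yes _ = removeKey z es
... | no _ = (u , v) ∷ removeKey z es

apply-removeKey⇒ : ∀ z (N : FinFun 1) a {d} →
  apply (removeKey z N) (a ∷ []) ≡ just d → apply N (a ∷ []) ≡ just d × a ≢ z
apply-removeKey⇒ z [] a ()
apply-removeKey⇒ z ((u , v) ∷ es) a e with ≡-dec ℕ._≟_ u (z ∷ [])
apply-removeKey⇒ z ((u , v) ∷ es) a e | yes u≡z with ≡-dec ℕ._≟_ u (a ∷ [])
... | yes u≡a = ⊥-elim (proj₂ (apply-removeKey⇒ z es a e) (∷-injectiveˡ (trans (sym u≡a) u≡z)))
... | no _ = apply-removeKey⇒ z es a e
apply-removeKey⇒ z ((u , v) ∷ es) a e | no u≢z with ≡-dec ℕ._≟_ u (a ∷ [])
... | yes u≡a = e , (λ a≡z → u≢z (trans u≡a (cong (_∷ []) a≡z)))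
... | no _ = apply-removeKey⇒ z es a e

apply-removeKey-other : ∀ z (N : FinFun 1) a → a ≢ z → apply (removeKey z N) (a ∷ []) ≡ apply N (a ∷ [])
apply-removeKey-other z [] a a≢z = refl
apply-removeKey-other z ((u , v) ∷ es) a a≢z with ≡-dec ℕ._≟_ u (z ∷ [])
apply-removeKey-other z ((u , v) ∷ es) a a≢z | yes u≡z with ≡-dec ℕ._≟_ u (a ∷ [])
... | yes u≡a = ⊥-elim (a≢z (∷-injectiveˡ (trans (sym u≡a) u≡z)))
... | no _ = apply-removeKey-other z es a a≢z
apply-removeKey-other z ((u , v) ∷ es) a a≢z | no u≢z with ≡-dec ℕ._≟_ u (a ∷ [])
... | yes u≡a = refl
... | no _ = apply-removeKey-other z es a a≢z

length-removeKey-≤ : ∀ z (N : FinFun 1) → length (removeKey z N) ≤ length N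
length-removeKey-≤ z [] = z≤n
length-removeKey-≤ z ((u , v) ∷ es) with ≡-dec ℕ._≟_ u (z ∷ [])
... | yes _ = ℕP.m≤n⇒m≤1+n (length-removeKey-≤ z es)
... | no _ = s≤s (length-removeKey-≤ z es)

length-removeKey-< : ∀ z (N : FinFun 1) {c} → apply N (z ∷ []) ≡ just c → length (removeKey z N) < length N
length-removeKey-< z [] ()
length-removeKey-< z ((u , v) ∷ es) e with ≡-dec ℕ._≟_ u (z ∷ [])
length-removeKey-< z ((u , v) ∷ es) e | yes _ = s≤s (length-removeKey-≤ z es)
length-removeKey-< z ((u , v) ∷ es) e | no u≢z with ≡-dec ℕ._≟_ u (z ∷ [])
... | yes u≡z = ⊥-elim (u≢z u≡z)
... | no _ = s≤s (length-removeKey-< z es e)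

Yields-≋ : ∀ {V : Vocabulary} {P : Prog V} → Capture P →
  ∀ {S₁ S₂ S₁' S₂' : Struct V} → Yields P S₁ S₂ → S₁ ≋ S₁' → S₂ ≋ S₂' → Yields P S₁' S₂'
Yields-≋ {V} capP {S₁} {S₂} {S₁'} {S₂'} y e₁ e₂ =
  let (η , h) = sound S₁ S₂ y in
  complete S₁' S₂' η (to (⟦⟧-≋ (≋-++⁺ Δ {η} ≋-refl (≋-++⁺ V e₁ e₂)) ψ) h)
  where open Capture capP

module Chains {V : Vocabulary} (G : Formula V) (g : QF G) {P : Prog V} (capP : Capture P)
              (T : Atom → Struct V) (e : Atom) (halts : ¬ ⟦ G ⟧ (T e)) where

  record Chain (N : FinFun 1) (z : Atom) : Set where
    field
      injective       : ∀ a b c → apply N (a ∷ []) ≡ just c → apply N (b ∷ []) ≡ just c → a ≡ b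
      start-unreached : ∀ a → apply N (a ∷ []) ≢ just z
      start-continues : z ≡ e ⊎ Σ Atom λ c → apply N (z ∷ []) ≡ just c
      continues       : ∀ a c → apply N (a ∷ []) ≡ just c → c ≡ e ⊎ Σ Atom λ d → apply N (c ∷ []) ≡ just d
      step            : ∀ a c → apply N (a ∷ []) ≡ just c → ⟦ G ⟧ (T a) × Yields P (T a) (T c)
  open Chain

  Chain-tail : ∀ N z c → Chain N z → apply N (z ∷ []) ≡ just c → Chain (removeKey z N) c
  Chain-tail N z c ch z↦c = record
    { injective = λ a b d a↦d b↦d → injective ch a b d (kept a a↦d) (kept b b↦d)
    ; start-unreached = λ a a↦c → proj₂ (apply-removeKey⇒ z N a a↦c) (injective ch a z c (kept a a↦c) z↦c)
    ; start-continues = [ inj₁ , (λ (d , c↦d) → inj₂ (d , trans (apply-removeKey-other z N c c≢z) c↦d)) ]′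
                        (continues ch z c z↦c)
    ; continues = λ a c' a↦c' →
        [ inj₁ , (λ (d , c'↦d) → inj₂ (d , trans (apply-removeKey-other z N c' (c'≢z a c' (kept a a↦c'))) c'↦d)) ]′
        (continues ch a c' (kept a a↦c'))
    ; step = λ a c' a↦c' → step ch a c' (kept a a↦c') }
    where
    kept : ∀ a {d} → apply (removeKey z N) (a ∷ []) ≡ just d → apply N (a ∷ []) ≡ just d
    kept a a↦d = proj₁ (apply-removeKey⇒ z N a a↦d)

    c'≢z : ∀ a c' → apply N (a ∷ []) ≡ just c' → c' ≢ z
    c'≢z a c' a↦c' refl = start-unreached ch a a↦c'

    c≢z : c ≢ z
    c≢z = c'≢z z c z↦c

  -- Each iteration removes the key z from N, so length N bounds the number of iterations.
  Chain⇒Yields : ∀ fuel N z → length N ≤ fuel → Chain N z →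
    ∀ {A B} → T z ≋ A → T e ≋ B → Yields (doWhile G g P) A B
  Chain⇒Yields fuel N z bound ch z≋A e≋B with start-continues ch
  ... | inj₁ refl = y-doF (λ holds → halts (from (⟦⟧-≋ z≋A G) holds)) (≋⇒Same (≋-trans (≋-sym e≋B) z≋A))
  Chain⇒Yields zero [] z bound ch z≋A e≋B | inj₂ (c , ())
  Chain⇒Yields (suc fuel) N z bound ch z≋A e≋B | inj₂ (c , z↦c) =
    let (holds , yP) = step ch z c z↦c in
    y-doT (to (⟦⟧-≋ z≋A G) holds) (Yields-≋ capP yP z≋A ≋-refl)
          (Chain⇒Yields fuel (removeKey z N) c (ℕP.≤-pred (ℕP.≤-trans (length-removeKey-< z N z↦c) bound))
                        (Chain-tail N z c ch z↦c) ≋-refl e≋B)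

predecessors : ℕ → FinFun 1
predecessors zero = []
predecessors (suc n) = ((suc n ∷ []) , n) ∷ predecessors n

apply-predecessors⇒ : ∀ n a {c} → apply (predecessors n) (a ∷ []) ≡ just c → a ≡ suc c × c < n
apply-predecessors⇒ zero a ()
apply-predecessors⇒ (suc n) a e with ≡-dec ℕ._≟_ (suc n ∷ []) (a ∷ [])
apply-predecessors⇒ (suc n) a refl | yes p = sym (∷-injectiveˡ p) , ℕP.≤-refl
... | no _ = let (a≡ , c<n) = apply-predecessors⇒ n a e in a≡ , ℕP.m≤n⇒m≤1+n c<n

apply-predecessors : ∀ n c → c < n → apply (predecessors n) (suc c ∷ []) ≡ just c
apply-predecessors (suc n) c c<1+n with ≡-dec ℕ._≟_ (suc n ∷ []) (suc c ∷ [])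
... | yes p = cong just (ℕP.suc-injective (∷-injectiveˡ p))
... | no np =
  apply-predecessors n c (ℕP.≤∧≢⇒< (ℕP.≤-pred c<1+n) (λ e → np (cong (λ x → suc x ∷ []) (sym e))))

module _ (n : ℕ) where

  private
    pred⊥ : Atom⊥ → Atom⊥
    pred⊥ u = apply⊥ (predecessors n) (u ∷ [])

  predecessors-injective : ∀ (u w : Atom⊥) → pred⊥ u ≢ nothing → pred⊥ u ≡ pred⊥ w → u ≡ w
  predecessors-injective nothing w defined _ = ⊥-elim (defined refl)
  predecessors-injective (just a) nothing defined eq = ⊥-elim (defined eq)
  predecessors-injective (just a) (just b) defined eq with apply (predecessors n) (a ∷ []) in a↦
  ... | nothing = ⊥-elim (defined refl)
  ... | just c =
    cong just (trans (proj₁ (apply-predecessors⇒ n a a↦)) (sym (proj₁ (apply-predecessors⇒ n b (sym eq)))))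

  predecessors-top-unreached : ∀ (u : Atom⊥) → pred⊥ u ≢ just n
  predecessors-top-unreached nothing ()
  predecessors-top-unreached (just a) e = ℕP.<-irrefl refl (proj₂ (apply-predecessors⇒ n a e))


  predecessors-continue : ∀ (u : Atom⊥) → u ≢ nothing × pred⊥ u ≢ nothing →
    pred⊥ u ≡ just 0 ⊎ pred⊥ (pred⊥ u) ≢ nothing
  predecessors-continue nothing (defined , _) = ⊥-elim (defined refl)
  predecessors-continue (just a) (_ , defined) with apply (predecessors n) (a ∷ []) in a↦
  ... | nothing = ⊥-elim (defined refl)
  ... | just zero = inj₁ refl
  ... | just (suc c) = inj₂ λ e → just≢nothing
    (trans (sym (apply-predecessors n c (ℕP.<-trans (ℕP.n<1+n c) (proj₂ (apply-predecessors⇒ n a a↦))))) e)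

predecessors-top-continues : ∀ n →
  (_≡_ {A = Atom⊥} (just n) (just 0)) ⊎ (apply⊥ (predecessors n) (just n ∷ []) ≢ nothing)
predecessors-top-continues zero = inj₁ refl
predecessors-top-continues (suc m) =
  inj₂ λ e → just≢nothing (trans (sym (apply-predecessors (suc m) m ℕP.≤-refl)) e)

module Loop {V : Vocabulary} (G : Formula V) (g : QF G) {P : Prog V} (capP : Capture P) where
  open Capture capP renaming (Δ to Δp; ψ to ψp; ψ-FO to ψp-FO; sound to soundP; complete to completeP)

  -- The indices e and z of the final and the initial state, the successor N
  -- on indices, and the families of the body's witnesses and of the states.
  Δ : Ctx
  Δ = 0 ∷ 0 ∷ 1 ∷ (sucs Δp ++ sucs V)

  private
    Γ : Ctx
    Γ = Δ ++ (V ++ V)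

    Γ² : Ctx
    Γ² = 0 ∷ 0 ∷ Γ

    end start : 0 ∈ Γ
    end = here refl
    start = there (here refl)

    next : 1 ∈ Γ
    next = there (there (here refl))

    witnessAt : ∀ {k} → k ∈ Δp → suc k ∈ Γ
    witnessAt x = there (there (there (++⁺ˡ (++⁺ˡ (suc∈ x)))))

    stateAt : ∀ {k} → k ∈ V → suc k ∈ Γ
    stateAt y = there (there (there (++⁺ˡ (++⁺ʳ (sucs Δp) (suc∈ y)))))

    initial final : ∀ {k} → k ∈ V → k ∈ Γ
    initial y = ++⁺ʳ Δ (++⁺ˡ y)
    final y = ++⁺ʳ Δ (++⁺ʳ V y)

    atom : ∀ {Γ'} → 0 ∈ Γ' → Term Γ'
    atom p = app p []

    _·_ : ∀ {Γ'} → 1 ∈ Γ' → Term Γ' → Term Γ'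
    N · t = app N (t ∷ [])

    i j : Term Γ²
    i = atom (there (here refl))
    j = atom (here refl)

    N² : 1 ∈ Γ²
    N² = there (there next)

    σ-initial σ-final : Subst (V ++ V) Γ
    σ-initial = substCase V (rename initial) (sectionSubst start stateAt)
    σ-final = substCase V (rename final) (sectionSubst end stateAt)

    σ-end : Subst V Γ
    σ-end = sectionSubst end stateAt

    σ-i : Subst V Γ²
    σ-i = sectionSubst (there (here refl)) (λ y → there (there (stateAt y)))

    σ-body : Subst (Δp ++ (V ++ V)) Γ²
    σ-body = substCase Δp (sectionSubst (there (here refl)) (λ x → there (there (witnessAt x))))
               (substCase V σ-i (sectionSubst (here refl) (λ y → there (there (stateAt y)))))

  startDefined endDefined initialState finalState halting : Formula Γ
  stepping injectivity startUnreached startContinues continuing : Formula Γ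
  startDefined = neg (atom start ≐ ω)
  endDefined = neg (atom end ≐ ω)
  initialState = substFormula σ-initial (unchanged {V})
  finalState = substFormula σ-final (unchanged {V})
  halting = neg (substFormula σ-end G)
  stepping = all 0 (all 0 (impl (conj (neg (i ≐ ω)) (conj (neg (j ≐ ω)) (N² · i ≐ j)))
                                (conj (substFormula σ-i G) (substFormula σ-body ψp))))
  injectivity = all 0 (all 0 (impl (conj (neg (N² · i ≐ ω)) (N² · i ≐ N² · j)) (i ≐ j)))
  startUnreached = all 0 (neg (there next · atom (here refl) ≐ atom (there start)))
  startContinues = disj (atom start ≐ atom end) (neg (next · atom start ≐ ω))
  continuing = all 0 (impl (conj (neg (atom (here refl) ≐ ω)) (neg (there next · atom (here refl) ≐ ω)))
                           (disj (there next · atom (here refl) ≐ atom (there end))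
                                 (neg (there next · (there next · atom (here refl)) ≐ ω))))

  ψ : Formula Γ
  ψ = conj startDefined (conj endDefined (conj initialState (conj finalState (conj halting
        (conj stepping (conj injectivity (conj startUnreached (conj startContinues continuing))))))))

  ψ-FO : FO ψ
  ψ-FO = fo-conj (fo-neg fo-eq) (fo-conj (fo-neg fo-eq) (fo-conj initialState-FO (fo-conj finalState-FO
           (fo-conj halting-FO (fo-conj stepping-FO (fo-conj injectivity-FO (fo-conj startUnreached-FO
           (fo-conj startContinues-FO continuing-FO))))))))
    where
    initialState-FO = FO-substFormula σ-initial (FO-unchanged {V})
    finalState-FO = FO-substFormula σ-final (FO-unchanged {V})
    halting-FO = fo-neg (FO-substFormula σ-end (QF⇒FO g))
    stepping-FO = fo-all (fo-all (fo-impl (fo-conj (fo-neg fo-eq) (fo-conj (fo-neg fo-eq) fo-eq))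
                                          (fo-conj (FO-substFormula σ-i (QF⇒FO g)) (FO-substFormula σ-body ψp-FO))))
    injectivity-FO = fo-all (fo-all (fo-impl (fo-conj (fo-neg fo-eq) fo-eq) fo-eq))
    startUnreached-FO = fo-all (fo-neg fo-eq)
    startContinues-FO = fo-disj fo-eq (fo-neg fo-eq)
    continuing-FO = fo-all (fo-impl (fo-conj (fo-neg fo-eq) (fo-neg fo-eq)) (fo-disj fo-eq (fo-neg fo-eq)))

  module Interpretation (fe fz : FinFun 0) (N : FinFun 1) (witnesses : Env (sucs Δp)) (states : Env (sucs V))
                        (A B : Struct V) where
    indexed : Env Δ
    indexed = fe ∷ fz ∷ N ∷ ++⁺ witnesses states

    ρ : Env Γ
    ρ = ++⁺ indexed (++⁺ A B)

    stateAtIndex : Atom⊥ → Struct V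
    stateAtIndex = sectionEnv states

    witnessAtIndex : Atom⊥ → Env Δp
    witnessAtIndex = sectionEnv witnesses

    private
      lookup-stateAt : ∀ {k} (y : k ∈ V) → lookup ρ (stateAt y) ≡ lookup states (suc∈ y)
      lookup-stateAt y = trans (lookup-++⁺ˡ (++⁺ witnesses states) (++⁺ A B) (++⁺ʳ (sucs Δp) (suc∈ y)))
                               (lookup-++⁺ʳ (sucs Δp) witnesses states (suc∈ y))

      lookup-witnessAt : ∀ {k} (x : k ∈ Δp) → lookup ρ (witnessAt x) ≡ lookup witnesses (suc∈ x)
      lookup-witnessAt x = trans (lookup-++⁺ˡ (++⁺ witnesses states) (++⁺ A B) (++⁺ˡ (suc∈ x)))
                                 (lookup-++⁺ˡ witnesses states (suc∈ x))

      lookup-initial : ∀ {k} (y : k ∈ V) → lookup ρ (initial y) ≡ lookup A y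
      lookup-initial y = trans (lookup-++⁺ʳ Δ indexed (++⁺ A B) (++⁺ˡ y)) (lookup-++⁺ˡ A B y)

      lookup-final : ∀ {k} (y : k ∈ V) → lookup ρ (final y) ≡ lookup B y
      lookup-final y = trans (lookup-++⁺ʳ Δ indexed (++⁺ A B) (++⁺ʳ V y)) (lookup-++⁺ʳ V A B y)

    Agree-initial : ∀ {v} → apply⊥ fz [] ≡ v → Agree σ-initial (++⁺ A (stateAtIndex v)) ρ
    Agree-initial z≡v = Agree-substCase V (rename initial) (sectionSubst start stateAt) {A} {stateAtIndex _}
      (Agree-rename initial lookup-initial) (Agree-sectionSubst start stateAt states lookup-stateAt z≡v)

    Agree-final : ∀ {v} → apply⊥ fe [] ≡ v → Agree σ-final (++⁺ B (stateAtIndex v)) ρ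
    Agree-final e≡v = Agree-substCase V (rename final) (sectionSubst end stateAt) {B} {stateAtIndex _}
      (Agree-rename final lookup-final) (Agree-sectionSubst end stateAt states lookup-stateAt e≡v)

    Agree-end : ∀ {v} → apply⊥ fe [] ≡ v → Agree σ-end (stateAtIndex v) ρ
    Agree-end = Agree-sectionSubst end stateAt states lookup-stateAt

    module _ (fi fj : FinFun 0) where
      ρ² : Env Γ²
      ρ² = fj ∷ fi ∷ ρ

      Agree-i : ∀ {v} → apply⊥ fi [] ≡ v → Agree σ-i (stateAtIndex v) ρ²
      Agree-i = Agree-sectionSubst (there (here refl)) (λ y → there (there (stateAt y))) states lookup-stateAt

      Agree-body : ∀ {v w} → apply⊥ fi [] ≡ v → apply⊥ fj [] ≡ w →
        Agree σ-body (++⁺ (witnessAtIndex v) (++⁺ (stateAtIndex v) (stateAtIndex w))) ρ²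
      Agree-body i≡v j≡w = Agree-substCase Δp _ _ {witnessAtIndex _} {++⁺ (stateAtIndex _) (stateAtIndex _)}
        (Agree-sectionSubst (there (here refl)) (λ x → there (there (witnessAt x))) witnesses lookup-witnessAt i≡v)
        (Agree-substCase V σ-i _ {stateAtIndex _} {stateAtIndex _} (Agree-i i≡v)
          (Agree-sectionSubst (here refl) (λ y → there (there (stateAt y))) states lookup-stateAt j≡w))

  complete : ∀ (A B : Struct V) (η : Env Δ) → ⟦ ψ ⟧ (++⁺ η (++⁺ A B)) → Yields (doWhile G g P) A B
  complete A B (fe ∷ fz ∷ N ∷ W)
      (z≠⊥ , e≠⊥ , initial✓ , final✓ , halting✓ , stepping✓ , injectivity✓ , unreached✓ , startContinues✓ , continuing✓)
      with ++⁺-surjective (sucs Δp) W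
  ... | witnesses , states , refl = Chain⇒Yields (length N) N z ℕP.≤-refl chain z≋A e≋B
    where
    open Interpretation fe fz N witnesses states A B
    z = proj₁ (≢nothing⇒just _ z≠⊥)
    z≡ = proj₂ (≢nothing⇒just _ z≠⊥)
    e = proj₁ (≢nothing⇒just _ e≠⊥)
    e≡ = proj₂ (≢nothing⇒just _ e≠⊥)

    open Chains G g capP (λ a → stateAtIndex (just a)) e
                (λ holds → halting✓ (from (⟦substFormula⟧ (Agree-end e≡) G) holds))

    z≋A : stateAtIndex (just z) ≋ A
    z≋A = Same⇒≋ (to (⟦unchanged⟧ A _) (to (⟦substFormula⟧ (Agree-initial z≡) (unchanged {V})) initial✓))

    e≋B : stateAtIndex (just e) ≋ B
    e≋B = Same⇒≋ (to (⟦unchanged⟧ B _) (to (⟦substFormula⟧ (Agree-final e≡) (unchanged {V})) final✓))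

    next-defined : ∀ {u} a → u ≡ just a → apply⊥ N (u ∷ []) ≢ nothing →
      Σ Atom λ c → apply N (a ∷ []) ≡ just c
    next-defined a refl defined = ≢nothing⇒just _ defined

    chain : Chain N z
    chain = record
      { injective = λ a b c a↦c b↦c → just-injective
          (injectivity✓ (constant (just a)) (constant (just b))
                        ((λ q → just≢nothing (trans (sym a↦c) q)) , trans a↦c (sym b↦c)))
      ; start-unreached = λ a a↦z → unreached✓ (constant (just a)) (trans a↦z (sym z≡))
      ; start-continues = [ (λ z≡e → inj₁ (just-injective (trans (sym z≡) (trans z≡e e≡))))
                          , (λ defined → inj₂ (next-defined z z≡ defined)) ]′ startContinues✓
      ; continues = λ a c a↦c →
          [ (λ c≡e → inj₁ (just-injective (trans (sym a↦c) (trans c≡e e≡))))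
          , (λ defined → inj₂ (next-defined c a↦c defined)) ]′
          (continuing✓ (constant (just a)) ((λ ()) , (λ q → just≢nothing (trans (sym a↦c) q))))
      ; step = λ a c a↦c →
          let (holds , body) = stepping✓ (constant (just a)) (constant (just c)) ((λ ()) , (λ ()) , a↦c) in
          to (⟦substFormula⟧ (Agree-i _ _ refl) G) holds
          , completeP _ _ (witnessAtIndex (just a)) (to (⟦substFormula⟧ (Agree-body _ _ refl refl) ψp) body) }

  -- A run with len iterations, stored downwards: index len holds the
  -- initial state and index 0 the final one, so the successor function is
  -- c + 1 ↦ c and a run is extended at the top.
  record Run (A B : Struct V) : Set where
    field
      len             : ℕ
      witnesses       : Env (sucs Δp)
      states          : Env (sucs V)
      initial≋        : sectionAt states len ≋ A
      final≋          : sectionAt states 0 ≋ B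
      halts           : ¬ ⟦ G ⟧ (sectionAt states 0)
      steps           : ∀ c → c < len → ⟦ G ⟧ (sectionAt states (suc c)) ×
                          ⟦ ψp ⟧ (++⁺ (sectionAt witnesses (suc c))
                                     (++⁺ (sectionAt states (suc c)) (sectionAt states c)))
      statesUnused    : ∀ c → len < c → sectionAt states c ≋ emptyEnv V
      witnessesUnused : ∀ c → len < c → sectionAt witnesses c ≋ emptyEnv Δp

  run-halt : ∀ {A B} → ¬ ⟦ G ⟧ A → Same A B → Run A B
  run-halt {A} fails same = record
    { len = 0 ; witnesses = graftEnv 0 (emptyEnv Δp) (emptyEnv _) ; states = graftEnv 0 A (emptyEnv _)
    ; initial≋ = stateHere
    ; final≋ = ≋-trans stateHere (≋-sym (Same⇒≋ same))
    ; halts = λ holds → fails (to (⟦⟧-≋ stateHere G) holds)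
    ; steps = λ c ()
    ; statesUnused = λ c 0<c →
        ≋-trans (sectionEnv-graftEnv-other 0 c A _ (<⇒≢ 0<c)) (sectionEnv-emptyEnv V (just c))
    ; witnessesUnused = λ c 0<c →
        ≋-trans (sectionEnv-graftEnv-other 0 c _ _ (<⇒≢ 0<c)) (sectionEnv-emptyEnv Δp (just c)) }
    where
    stateHere = sectionEnv-graftEnv-same 0 A (emptyEnv _) (sectionEnv-emptyEnv V (just 0))
    <⇒≢ : ∀ {m n} → m < n → m ≢ n
    <⇒≢ m<n refl = ℕP.<-irrefl refl m<n

  run-step : ∀ {A S B} → ⟦ G ⟧ A → Yields P A S → Run S B → Run A B
  run-step {A} {S} holds yP r = record
    { len = suc len ; witnesses = witnesses' ; states = states'
    ; initial≋ = stateTop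
    ; final≋ = ≋-trans (stateBelow 0 (λ ())) final≋
    ; halts = λ holds₀ → halts (to (⟦⟧-≋ (stateBelow 0 (λ ())) G) holds₀)
    ; steps = steps'
    ; statesUnused = λ c lt → ≋-trans (stateBelow c (<⇒≢ lt)) (statesUnused c (ℕP.<-trans (ℕP.n<1+n len) lt))
    ; witnessesUnused = λ c lt →
        ≋-trans (witnessBelow c (<⇒≢ lt)) (witnessesUnused c (ℕP.<-trans (ℕP.n<1+n len) lt)) }
    where
    open Run r
    η = proj₁ (soundP A S yP)
    witnesses' = graftEnv (suc len) η witnesses
    states' = graftEnv (suc len) A states

    <⇒≢ : ∀ {m n} → m < n → m ≢ n
    <⇒≢ m<n refl = ℕP.<-irrefl refl m<n

    >⇒≢ : ∀ {m n} → m < n → n ≢ m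
    >⇒≢ m<n refl = ℕP.<-irrefl refl m<n

    stateTop : sectionAt states' (suc len) ≋ A
    stateTop = sectionEnv-graftEnv-same (suc len) A states (statesUnused (suc len) (ℕP.n<1+n len))

    witnessTop : sectionAt witnesses' (suc len) ≋ η
    witnessTop = sectionEnv-graftEnv-same (suc len) η witnesses (witnessesUnused (suc len) (ℕP.n<1+n len))

    stateBelow : ∀ c → suc len ≢ c → sectionAt states' c ≋ sectionAt states c
    stateBelow c = sectionEnv-graftEnv-other (suc len) c A states

    witnessBelow : ∀ c → suc len ≢ c → sectionAt witnesses' c ≋ sectionAt witnesses c
    witnessBelow c = sectionEnv-graftEnv-other (suc len) c η witnesses

    steps' : ∀ c → c < suc len → ⟦ G ⟧ (sectionAt states' (suc c)) ×
               ⟦ ψp ⟧ (++⁺ (sectionAt witnesses' (suc c)) (++⁺ (sectionAt states' (suc c)) (sectionAt states' c)))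
    steps' c c<1+len with c ℕ.≟ len
    ... | yes refl =
      to (⟦⟧-≋ (≋-sym stateTop) G) holds ,
      to (⟦⟧-≋ (≋-++⁺ Δp (≋-sym witnessTop)
                        (≋-++⁺ V (≋-sym stateTop) (≋-sym (≋-trans (stateBelow c (>⇒≢ c<1+len)) initial≋)))) ψp)
         (proj₂ (soundP A S yP))
    ... | no c≢len =
      let (holds₁ , body) = steps c (ℕP.≤∧≢⇒< (ℕP.≤-pred c<1+len) c≢len)
          above = stateBelow (suc c) (λ e → c≢len (sym (ℕP.suc-injective e)))
      in to (⟦⟧-≋ (≋-sym above) G) holds₁ ,
         to (⟦⟧-≋ (≋-++⁺ Δp (≋-sym (witnessBelow (suc c) (λ e → c≢len (sym (ℕP.suc-injective e)))))
                            (≋-++⁺ V (≋-sym above) (≋-sym (stateBelow c (>⇒≢ c<1+len))))) ψp) body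

  Yields⇒Run : ∀ {A B} → Yields (doWhile G g P) A B → Run A B
  Yields⇒Run (y-doF fails same) = run-halt fails same
  Yields⇒Run (y-doT holds yP rest) = run-step holds yP (Yields⇒Run rest)

  sound : ∀ (A B : Struct V) → Yields (doWhile G g P) A B → Σ (Env Δ) λ η → ⟦ ψ ⟧ (++⁺ η (++⁺ A B))
  sound A B y = fe ∷ fz ∷ N ∷ ++⁺ witnesses states
    , (λ ()) , (λ ()) , initial✓ , final✓ , halting✓ , stepping✓
    , (λ fi fj (defined , same) → predecessors-injective len (apply⊥ fi []) (apply⊥ fj []) defined same)
    , (λ fi → predecessors-top-unreached len (apply⊥ fi []))
    , predecessors-top-continues len
    , (λ fj → predecessors-continue len (apply⊥ fj []))
    where
    open Run (Yields⇒Run y)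
    fe = constant (just 0)
    fz = constant (just len)
    N = predecessors len
    open Interpretation fe fz N witnesses states A B

    initial✓ : ⟦ initialState ⟧ ρ
    initial✓ = from (⟦substFormula⟧ (Agree-initial refl) (unchanged {V}))
                    (from (⟦unchanged⟧ A _) (≋⇒Same initial≋))

    final✓ : ⟦ finalState ⟧ ρ
    final✓ = from (⟦substFormula⟧ (Agree-final refl) (unchanged {V})) (from (⟦unchanged⟧ B _) (≋⇒Same final≋))

    halting✓ : ⟦ halting ⟧ ρ
    halting✓ holds = halts (to (⟦substFormula⟧ (Agree-end refl) G) holds)

    stepping✓ : ⟦ stepping ⟧ ρ
    stepping✓ fi fj (i≠⊥ , j≠⊥ , i↦j) with ≢nothing⇒just _ i≠⊥ | ≢nothing⇒just _ j≠⊥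
    ... | a , i≡a | c , j≡c
        with apply-predecessors⇒ len a (subst₂ (λ u w → apply⊥ N (u ∷ []) ≡ w) i≡a j≡c i↦j)
    ... | refl , c<len =
      let (holds , body) = steps c c<len in
      from (⟦substFormula⟧ (Agree-i fi fj i≡a) G) holds ,
      from (⟦substFormula⟧ (Agree-body fi fj i≡a j≡c) ψp) body

  capture : Capture (doWhile G g P)
  capture = record { Δ = Δ ; ψ = ψ ; ψ-FO = ψ-FO ; sound = sound ; complete = complete }

capture : ∀ {V : Vocabulary} (P : Prog V) → Capture P
capture (extend x ts q) = capture-extend x ts q
capture (incept c) = capture-incept c
capture (contract x ts) = capture-contract x ts
capture (delete c) = capture-delete c
capture (P ⨾ Q) = Sequence.capture (capture P) (capture Q)
capture (ifte G g P Q) = Branch.capture G g (capture P) (capture Q)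
capture (doWhile G g P) = Loop.capture G g (capture P)

theorem5 : (V : Vocabulary) (P : Prog V) →
    Σ (Formula (V ++ V)) λ φ →
      Existential φ ×
      ((F G : Struct V) → ⟦ φ ⟧ (++⁺ F G) ⇔ Yields P F G)
theorem5 V P = exMany Δ ψ , Existential-exMany Δ (ex-fo ψ-FO) , λ F G →
  ⇔.trans (⟦exMany⟧ Δ ψ (++⁺ F G)) (mk⇔ (λ (η , h) → complete F G η h) (sound F G))
  where open Capture (capture P)
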